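{- $\mathrm{IPC}=\bigcap\{\mathrm{Th}(B): B \text{ a finite, weakly projective Brouwer algebra}\}=\bigcap\{\mathrm{Th}_H(H): H \text{ a finite, weakly projective Heyting algebra}\}$.
   Context: $\mathrm{IPC}$ is the set of theorems of intuitionistic propositional calculus, with formulas built from variables using $\vee,\wedge,\to,\neg$. A Brouwer algebra is a bounded distributive lattice $B$ (bottom $0$, top $1$) such that for all $a,b$ there is a least $a\to b$ with $a\sqcup(a\to b)\ge b$ ($\sqcup$ the lattice join); $\neg a=a\to 1$; a formula is true in $B$ if, interpreting $\vee$ as lattice meet, $\wedge$ as lattice join, and $\to,\neg$ as those of $B$, it evaluates to $0$ under every assignment; $\mathrm{Th}(B)$ is the set of such formulas. A Heyting algebra is a bounded distributive lattice $H$ such that for all $a,b$ there is a largest $a\to b$ with $a\wedge(a\to b)\le b$; $\neg a=a\to 0$; a formula is true in $H$ if, interpreting $\vee,\wedge$ as lattice join, meet and $\to,\neg$ as those of $H$, it evaluates to $1$ under every assignment; $\mathrm{Th}_H(H)$ is the set of such formulas. A distributive lattice $L$ is weakly projective if for every surjective lattice homomorphism $f:L_0\twoheadrightarrow L_1$ between distributive lattices and every lattice homomorphism $g:L\to L_1$ there is a lattice homomorphism $h:L\to L_0$ with $g=f\circ h$. -}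

module Defs where

open import Level using (0ℓ)
open import Data.Nat using (ℕ)
open import Data.Fin using (Fin)
open import Data.Product using (Σ; ∃; _×_)
open import Algebra.Core using (Op₂)
open import Relation.Binary.Core using (Rel)
open import Relation.Binary.Lattice.Structures using (IsBoundedLattice)
open import Relation.Binary.Lattice.Bundles
  using (Lattice; DistributiveLattice; HeytingAlgebra)

infixr 5 _⇒_
infixr 6 _∨f_
infixr 7 _∧f_

data Formula : Set where
  var  : ℕ → Formula
  _∨f_ : Formula → Formula → Formula
  _∧f_ : Formula → Formula → Formula
  _⇒_  : Formula → Formula → Formula
  ¬f_  : Formula → Formula

-- IPC: Kleene's Hilbert-style calculus for intuitionistic propositional
-- logic (with ¬ primitive); the theorems of IPC are the derivable formulas.
data IPC⊢_ : Formula → Set where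
  ax1 : ∀ A B → IPC⊢ (A ⇒ (B ⇒ A))
  ax2 : ∀ A B C → IPC⊢ ((A ⇒ B) ⇒ ((A ⇒ (B ⇒ C)) ⇒ (A ⇒ C)))
  ax3 : ∀ A B → IPC⊢ (A ⇒ (B ⇒ (A ∧f B)))
  ax4 : ∀ A B → IPC⊢ ((A ∧f B) ⇒ A)
  ax5 : ∀ A B → IPC⊢ ((A ∧f B) ⇒ B)
  ax6 : ∀ A B → IPC⊢ (A ⇒ (A ∨f B))
  ax7 : ∀ A B → IPC⊢ (B ⇒ (A ∨f B))
  ax8 : ∀ A B C → IPC⊢ ((A ⇒ C) ⇒ ((B ⇒ C) ⇒ ((A ∨f B) ⇒ C)))
  ax9 : ∀ A B → IPC⊢ ((A ⇒ B) ⇒ ((A ⇒ ¬f B) ⇒ ¬f A))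
  ax10 : ∀ A B → IPC⊢ (¬f A ⇒ (A ⇒ B))
  mp  : ∀ {A B} → IPC⊢ (A ⇒ B) → IPC⊢ A → IPC⊢ B

record BrouwerAlgebra : Set₁ where
  field
    Carrier : Set
    _≈_     : Rel Carrier 0ℓ
    _≤_     : Rel Carrier 0ℓ
    _∨_     : Op₂ Carrier
    _∧_     : Op₂ Carrier
    _⇨_     : Op₂ Carrier
    ⊤       : Carrier
    ⊥       : Carrier
    isBoundedLattice : IsBoundedLattice _≈_ _≤_ _∨_ _∧_ ⊤ ⊥
    ∧-distribˡ-∨ : ∀ x y z → (x ∧ (y ∨ z)) ≈ ((x ∧ y) ∨ (x ∧ z))
    ⇨-sound  : ∀ a b → b ≤ (a ∨ (a ⇨ b))
    ⇨-least  : ∀ a b c → b ≤ (a ∨ c) → (a ⇨ b) ≤ c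

  open IsBoundedLattice isBoundedLattice using (isLattice)

  lattice : Lattice 0ℓ 0ℓ 0ℓ
  lattice = record { isLattice = isLattice }

Finite : (A : Set) → Rel A 0ℓ → Set
Finite A _≈_ = Σ ℕ λ n → Σ (Fin n → A) λ e → ∀ a → ∃ λ i → e i ≈ a

record IsLatticeHom (L : Lattice 0ℓ 0ℓ 0ℓ) (M : Lattice 0ℓ 0ℓ 0ℓ)
       (f : Lattice.Carrier L → Lattice.Carrier M) : Set where
  private
    module L = Lattice L
    module M = Lattice M
  field
    cong   : ∀ {x y} → x L.≈ y → f x M.≈ f y
    ∨-hom  : ∀ x y → f (x L.∨ y) M.≈ (f x M.∨ f y)
    ∧-hom  : ∀ x y → f (x L.∧ y) M.≈ (f x M.∧ f y)

WeaklyProjective : Lattice 0ℓ 0ℓ 0ℓ → Set₁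
WeaklyProjective L =
  (L₀ L₁ : DistributiveLattice 0ℓ 0ℓ 0ℓ) →
  let module L₀ = DistributiveLattice L₀
      module L₁ = DistributiveLattice L₁ in
  (f : L₀.Carrier → L₁.Carrier) → IsLatticeHom L₀.lattice L₁.lattice f →
  (∀ y → ∃ λ x → f x L₁.≈ y) →
  (g : Lattice.Carrier L → L₁.Carrier) → IsLatticeHom L L₁.lattice g →
  Σ (Lattice.Carrier L → L₀.Carrier) λ h →
    IsLatticeHom L L₀.lattice h × (∀ x → g x L₁.≈ f (h x))

module _ (B : BrouwerAlgebra) where
  open BrouwerAlgebra B
  ⟦_⟧B : Formula → (ℕ → Carrier) → Carrier
  ⟦ var n ⟧B v = v n
  ⟦ φ ∨f ψ ⟧B v = ⟦ φ ⟧B v ∧ ⟦ ψ ⟧B v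
  ⟦ φ ∧f ψ ⟧B v = ⟦ φ ⟧B v ∨ ⟦ ψ ⟧B v
  ⟦ φ ⇒ ψ ⟧B v = ⟦ φ ⟧B v ⇨ ⟦ ψ ⟧B v
  ⟦ ¬f φ ⟧B v = ⟦ φ ⟧B v ⇨ ⊤

  TrueB : Formula → Set
  TrueB φ = ∀ v → ⟦ φ ⟧B v ≈ ⊥

module _ (H : HeytingAlgebra 0ℓ 0ℓ 0ℓ) where
  open HeytingAlgebra H
  ⟦_⟧H : Formula → (ℕ → Carrier) → Carrier
  ⟦ var n ⟧H v = v n
  ⟦ φ ∨f ψ ⟧H v = ⟦ φ ⟧H v ∨ ⟦ ψ ⟧H v
  ⟦ φ ∧f ψ ⟧H v = ⟦ φ ⟧H v ∧ ⟦ ψ ⟧H v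
  ⟦ φ ⇒ ψ ⟧H v = ⟦ φ ⟧H v ⇨ ⟦ ψ ⟧H v
  ⟦ ¬f φ ⟧H v = ⟦ φ ⟧H v ⇨ ⊥

  TrueH : Formula → Set
  TrueH φ = ∀ v → ⟦ φ ⟧H v ≈ ⊤

InAllFinWPBrouwer : Formula → Set₁
InAllFinWPBrouwer φ =
  (B : BrouwerAlgebra) →
  Finite (BrouwerAlgebra.Carrier B) (BrouwerAlgebra._≈_ B) →
  WeaklyProjective (BrouwerAlgebra.lattice B) →
  TrueB B φ

InAllFinWPHeyting : Formula → Set₁
InAllFinWPHeyting φ =
  (H : HeytingAlgebra 0ℓ 0ℓ 0ℓ) →
  Finite (HeytingAlgebra.Carrier H) (HeytingAlgebra._≈_ H) →
  WeaklyProjective (HeytingAlgebra.lattice H) →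
  TrueH H φ

module Submission where

-- Soundness holds in every Heyting algebra by induction on derivations,
-- and transfers to Brouwer algebras because the order dual of a Brouwer
-- algebra is a Heyting algebra with the same interpretation of formulas.
--
-- Completeness goes through finite trees.  A terminating proof search for
-- multi-succedent sequents either derives the goal in the Hilbert calculus
-- or produces a finite refutation tree: a Kripke countermodel whose frame
-- is a finite tree.  The up-sets of a finite tree form a finite Heyting
-- algebra, in which the countermodel refutes the goal (truth lemma).  The
-- up-set lattice of a finite tree is weakly projective: a lifting along a
-- surjective lattice homomorphism is built by recursion on the tree.
-- Dualising this algebra gives a finite weakly projective Brouwer algebra
-- refuting the goal, which finishes the proof.

open import Level using (0ℓ)
open import Function using (flip)
open import Function.Bundles using (_⇔_; mk⇔)
open import Data.Product using (Σ; Σ-syntax; ∃; _×_; _,_; proj₁; proj₂)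
open import Relation.Binary.PropositionalEquality as ≡
  using (_≡_; refl; cong; cong₂; sym; subst; subst₂)
open import Relation.Binary.Lattice.Bundles
  using (DistributiveLattice; HeytingAlgebra)
open import Relation.Binary.Lattice.Structures
  using (IsBoundedLattice; IsHeytingAlgebra)
import Relation.Binary.Construct.Flip.EqAndOrd as Flip
import Relation.Binary.Reasoning.Setoid as SetoidReasoning
import Relation.Binary.Lattice.Properties.HeytingAlgebra as HeytingProperties
import Relation.Binary.Lattice.Properties.DistributiveLattice as DistributiveProperties
import Relation.Binary.Lattice.Properties.Lattice as LatticeProperties
import Relation.Binary.Lattice.Properties.JoinSemilattice as JoinSemilatticeProperties
import Relation.Binary.Lattice.Properties.MeetSemilattice as MeetSemilatticeProperties
open import Data.Nat using (ℕ; suc)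
import Data.Nat as Nat
import Data.Nat.Properties as NatProps
open import Data.Nat.Induction using (<-wellFounded)
open import Induction.WellFounded using (Acc; acc)
open import Data.Sum using (_⊎_; inj₁; inj₂)
open import Data.Unit using (tt)
import Data.Unit as Unit
open import Data.Empty using (⊥-elim)
import Data.Empty as Empty
open import Relation.Nullary using (Dec; yes; no; ¬_)
open import Relation.Binary.Definitions using (DecidableEquality)
open import Data.List using (List; []; _∷_; _++_; map; cartesianProductWith; length; lookup)
open import Data.List.Membership.Propositional using (_∈_; _∉_)
import Data.List.Membership.DecPropositional as DecMembership
open import Data.List.Membership.Propositional.Properties
  using (∈-++⁺ˡ; ∈-++⁺ʳ; ∈-++⁻; ∈-map⁺; ∈-cartesianProductWith⁺)
open import Data.List.Relation.Unary.Any using (here; there; index)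
open import Data.List.Relation.Unary.Any.Properties using (lookup-index)
open import Defs

-- Brouwer algebras are order-dual Heyting algebras

module Duality where

  -- The order dual of a Brouwer algebra is a Heyting algebra: join and
  -- meet, 0 and 1 swap roles, and the least c with b ≤ a ∨ c is the
  -- largest c with c ∧ a ≤ b in the reversed order.
  heytingOf : BrouwerAlgebra → HeytingAlgebra 0ℓ 0ℓ 0ℓ
  heytingOf B = record
    { Carrier = Carrier ; _≈_ = _≈_ ; _≤_ = flip _≤_
    ; _∨_ = _∧_ ; _∧_ = _∨_ ; _⇨_ = _⇨_ ; ⊤ = ⊥ ; ⊥ = ⊤
    ; isHeytingAlgebra = record
      { isBoundedLattice = record
        { isLattice = record
          { isPartialOrder = Flip.isPartialOrder isPartialOrder
          ; supremum = infimum
          ; infimum = supremum }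
        ; maximum = minimum
        ; minimum = maximum }
      ; exponential = λ w x y →
          (λ y≤w∨x → ⇨-least x y w (trans y≤w∨x (∨-comm≤ w x)))
        , (λ x⇨y≤w → trans (⇨-sound x y)
                       (trans (∨-least (x≤x∨y x w) (trans x⇨y≤w (y≤x∨y x w)))
                              (∨-comm≤ x w))) } }
    where
      open BrouwerAlgebra B
      open IsBoundedLattice isBoundedLattice
      ∨-comm≤ : ∀ x y → (x ∨ y) ≤ (y ∨ x)
      ∨-comm≤ x y = ∨-least (y≤x∨y y x) (x≤x∨y y x)

  brouwerOf : HeytingAlgebra 0ℓ 0ℓ 0ℓ → BrouwerAlgebra
  brouwerOf H = record
    { Carrier = Carrier ; _≈_ = _≈_ ; _≤_ = flip _≤_
    ; _∨_ = _∧_ ; _∧_ = _∨_ ; _⇨_ = _⇨_ ; ⊤ = ⊥ ; ⊥ = ⊤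
    ; isBoundedLattice = record
      { isLattice = record
        { isPartialOrder = Flip.isPartialOrder isPartialOrder
        ; supremum = infimum
        ; infimum = supremum }
      ; maximum = minimum
      ; minimum = maximum }
    ; ∧-distribˡ-∨ = DistributiveProperties.∨-distribˡ-∧ distributiveLattice
    ; ⇨-sound = λ a b → ⇨-applyʳ ≤-refl
    ; ⇨-least = λ a b c a∧c≤b → swap-transpose-⇨ a∧c≤b }
    where
      open HeytingAlgebra H renaming (refl to ≤-refl)
      open HeytingProperties H using (⇨-applyʳ; swap-transpose-⇨; distributiveLattice)

  ⟦⟧-heytingOf : ∀ B φ v → ⟦_⟧B B φ v ≡ ⟦_⟧H (heytingOf B) φ v
  ⟦⟧-heytingOf B (var n) v = refl
  ⟦⟧-heytingOf B (φ ∨f ψ) v = cong₂ (BrouwerAlgebra._∧_ B) (⟦⟧-heytingOf B φ v) (⟦⟧-heytingOf B ψ v)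
  ⟦⟧-heytingOf B (φ ∧f ψ) v = cong₂ (BrouwerAlgebra._∨_ B) (⟦⟧-heytingOf B φ v) (⟦⟧-heytingOf B ψ v)
  ⟦⟧-heytingOf B (φ ⇒ ψ) v = cong₂ (BrouwerAlgebra._⇨_ B) (⟦⟧-heytingOf B φ v) (⟦⟧-heytingOf B ψ v)
  ⟦⟧-heytingOf B (¬f φ) v = cong (λ a → BrouwerAlgebra._⇨_ B a (BrouwerAlgebra.⊤ B)) (⟦⟧-heytingOf B φ v)

  ⟦⟧-brouwerOf : ∀ H φ v → ⟦_⟧B (brouwerOf H) φ v ≡ ⟦_⟧H H φ v
  ⟦⟧-brouwerOf H (var n) v = refl
  ⟦⟧-brouwerOf H (φ ∨f ψ) v = cong₂ (HeytingAlgebra._∨_ H) (⟦⟧-brouwerOf H φ v) (⟦⟧-brouwerOf H ψ v)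
  ⟦⟧-brouwerOf H (φ ∧f ψ) v = cong₂ (HeytingAlgebra._∧_ H) (⟦⟧-brouwerOf H φ v) (⟦⟧-brouwerOf H ψ v)
  ⟦⟧-brouwerOf H (φ ⇒ ψ) v = cong₂ (HeytingAlgebra._⇨_ H) (⟦⟧-brouwerOf H φ v) (⟦⟧-brouwerOf H ψ v)
  ⟦⟧-brouwerOf H (¬f φ) v = cong (λ a → HeytingAlgebra._⇨_ H a (HeytingAlgebra.⊥ H)) (⟦⟧-brouwerOf H φ v)

  dualDistributiveLattice : DistributiveLattice 0ℓ 0ℓ 0ℓ → DistributiveLattice 0ℓ 0ℓ 0ℓ
  dualDistributiveLattice D = record
    { _≤_ = flip _≤_
    ; _∨_ = _∧_
    ; _∧_ = _∨_
    ; isDistributiveLattice = record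
      { isLattice = LatticeProperties.∧-∨-isLattice lattice
      ; ∧-distribˡ-∨ = DistributiveProperties.∨-distribˡ-∧ D } }
    where open DistributiveLattice D

  -- Weak projectivity is self-dual: a lifting problem for the order dual
  -- of H is a lifting problem for H between the order duals of L₀ and L₁,
  -- and lattice homomorphisms stay homomorphisms when both sides are
  -- dualised.
  weaklyProjective-brouwerOf : ∀ H → WeaklyProjective (HeytingAlgebra.lattice H) →
    WeaklyProjective (BrouwerAlgebra.lattice (brouwerOf H))
  weaklyProjective-brouwerOf H wp L₀ L₁ f f-hom f-onto g g-hom =
    let h , h-hom , g≈f∘h = wp (dualDistributiveLattice L₀) (dualDistributiveLattice L₁)
          f (record { cong = ≈-cong f-hom ; ∨-hom = ∧-hom f-hom ; ∧-hom = ∨-hom f-hom }) f-onto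
          g (record { cong = ≈-cong g-hom ; ∨-hom = ∧-hom g-hom ; ∧-hom = ∨-hom g-hom })
    in h , record { cong = ≈-cong h-hom ; ∨-hom = ∧-hom h-hom ; ∧-hom = ∨-hom h-hom } , g≈f∘h
    where open IsLatticeHom renaming (cong to ≈-cong)

module Soundness where
  open Duality

  module _ (H : HeytingAlgebra 0ℓ 0ℓ 0ℓ) where
    open HeytingAlgebra H
    open HeytingProperties H using (⇨-eval; ∧-distribˡ-∨-≤)

    -- Modus ponens and λ-abstraction as inequalities below a context w.
    apply : ∀ {w x y} → w ≤ (x ⇨ y) → w ≤ x → w ≤ y
    apply w≤x⇨y w≤x = trans (∧-greatest w≤x⇨y w≤x) ⇨-eval

    abstr : ∀ {w x y} → (w ∧ x) ≤ y → w ≤ (x ⇨ y)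
    abstr = transpose-⇨

    -- The last three components of a context built by iterated meets,
    -- playing the role of de Bruijn variables 0, 1 and 2.
    var₀ : ∀ {w x} → (w ∧ x) ≤ x
    var₀ = x∧y≤y _ _

    var₁ : ∀ {w x y} → ((w ∧ x) ∧ y) ≤ x
    var₁ = trans (x∧y≤x _ _) var₀

    var₂ : ∀ {w x y z} → (((w ∧ x) ∧ y) ∧ z) ≤ x
    var₂ = trans (x∧y≤x _ _) var₁

    valid : ∀ {x} → ⊤ ≤ x → x ≈ ⊤
    valid = antisym (maximum _)

    soundH : ∀ {φ} → IPC⊢ φ → TrueH H φ
    soundH (ax1 A B) v = valid (abstr (abstr var₁))
    soundH (ax2 A B C) v = valid (abstr (abstr (abstr (apply (apply var₁ var₀) (apply var₂ var₀)))))
    soundH (ax3 A B) v = valid (abstr (abstr (∧-greatest var₁ var₀)))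
    soundH (ax4 A B) v = valid (abstr (trans var₀ (x∧y≤x _ _)))
    soundH (ax5 A B) v = valid (abstr (trans var₀ (x∧y≤y _ _)))
    soundH (ax6 A B) v = valid (abstr (trans var₀ (x≤x∨y _ _)))
    soundH (ax7 A B) v = valid (abstr (trans var₀ (y≤x∨y _ _)))
    soundH (ax8 A B C) v = valid (abstr (abstr (abstr
      (trans (∧-distribˡ-∨-≤ _ _ _) (∨-least (apply var₂ var₀) (apply var₁ var₀))))))
    soundH (ax9 A B) v = valid (abstr (abstr (abstr (apply (apply var₁ var₀) (apply var₂ var₀)))))
    soundH (ax10 A B) v = valid (abstr (abstr (trans (apply var₁ var₀) (minimum _))))
    soundH (mp d e) v = valid (apply (reflexive (Eq.sym (soundH d v))) (reflexive (Eq.sym (soundH e v))))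

  -- Brouwer soundness is Heyting soundness in the order dual.
  soundB : ∀ B {φ} → IPC⊢ φ → TrueB B φ
  soundB B {φ} d v = subst (λ a → BrouwerAlgebra._≈_ B a (BrouwerAlgebra.⊥ B))
    (sym (⟦⟧-heytingOf B φ v)) (soundH (heytingOf B) d v)

-- Derivations from hypotheses and the deduction theorem

module Hilbert where

  infix 3 _⊢_

  data _⊢_ (Γ : List Formula) : Formula → Set where
    hyp : ∀ {A} → A ∈ Γ → Γ ⊢ A
    thm : ∀ {A} → IPC⊢ A → Γ ⊢ A
    app : ∀ {A B} → Γ ⊢ A ⇒ B → Γ ⊢ A → Γ ⊢ B

  _⊆_ : List Formula → List Formula → Set
  Γ ⊆ Δ = ∀ {x} → x ∈ Γ → x ∈ Δ

  closed : ∀ {A} → [] ⊢ A → IPC⊢ A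
  closed (thm t) = t
  closed (app d e) = mp (closed d) (closed e)

  identity : ∀ A → IPC⊢ (A ⇒ A)
  identity A = mp (mp (ax2 A (A ⇒ A) A) (ax1 A A)) (ax1 A (A ⇒ A))

  deduction : ∀ {Γ A B} → (A ∷ Γ) ⊢ B → Γ ⊢ A ⇒ B
  deduction {A = A} (hyp (here refl)) = thm (identity A)
  deduction {A = A} (hyp (there p)) = app (thm (ax1 _ A)) (hyp p)
  deduction {A = A} (thm t) = app (thm (ax1 _ A)) (thm t)
  deduction {A = A} {B} (app {C} d e) = app (app (thm (ax2 A C B)) (deduction e)) (deduction d)

  weaken : ∀ {Γ Δ A} → Γ ⊆ Δ → Γ ⊢ A → Δ ⊢ A
  weaken Γ⊆Δ (hyp p) = hyp (Γ⊆Δ p)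
  weaken Γ⊆Δ (thm t) = thm t
  weaken Γ⊆Δ (app d e) = app (weaken Γ⊆Δ d) (weaken Γ⊆Δ e)

  cut : ∀ {Γ A B} → Γ ⊢ A → (A ∷ Γ) ⊢ B → Γ ⊢ B
  cut d e = app (deduction e) d

  -- A fixed refutable formula, used where a sequent has empty succedent.
  falsum : Formula
  falsum = ¬f (var 0 ⇒ var 0)

  ¬-elim : ∀ {Γ A} C → Γ ⊢ ¬f A → Γ ⊢ A → Γ ⊢ C
  ¬-elim C d e = app (app (thm (ax10 _ C)) d) e

  ¬-intro : ∀ {Γ A} → (A ∷ Γ) ⊢ falsum → Γ ⊢ ¬f A
  ¬-intro {A = A} d = app (app (thm (ax9 A (var 0 ⇒ var 0)))
    (app (thm (ax1 _ A)) (thm (identity (var 0))))) (deduction d)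

-- Proof search: every sequent is provable or has a saturated refutation tree.

module ProofSearch where
  open Hilbert
  open Nat using (_≤_; _<_; s≤s; z≤n)

  _≟F_ : DecidableEquality Formula
  var m ≟F var n with NatProps._≟_ m n
  ... | yes refl = yes refl
  ... | no m≢n = no λ { refl → m≢n refl }
  (A ∨f B) ≟F (C ∨f D) with A ≟F C | B ≟F D
  ... | yes refl | yes refl = yes refl
  ... | no A≢C | _ = no λ { refl → A≢C refl }
  ... | yes _ | no B≢D = no λ { refl → B≢D refl }
  (A ∧f B) ≟F (C ∧f D) with A ≟F C | B ≟F D
  ... | yes refl | yes refl = yes refl
  ... | no A≢C | _ = no λ { refl → A≢C refl }
  ... | yes _ | no B≢D = no λ { refl → B≢D refl }
  (A ⇒ B) ≟F (C ⇒ D) with A ≟F C | B ≟F D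
  ... | yes refl | yes refl = yes refl
  ... | no A≢C | _ = no λ { refl → A≢C refl }
  ... | yes _ | no B≢D = no λ { refl → B≢D refl }
  (¬f A) ≟F (¬f C) with A ≟F C
  ... | yes refl = yes refl
  ... | no A≢C = no λ { refl → A≢C refl }
  var _ ≟F (_ ∨f _) = no λ ()
  var _ ≟F (_ ∧f _) = no λ ()
  var _ ≟F (_ ⇒ _) = no λ ()
  var _ ≟F (¬f _) = no λ ()
  (_ ∨f _) ≟F var _ = no λ ()
  (_ ∨f _) ≟F (_ ∧f _) = no λ ()
  (_ ∨f _) ≟F (_ ⇒ _) = no λ ()
  (_ ∨f _) ≟F (¬f _) = no λ ()
  (_ ∧f _) ≟F var _ = no λ ()
  (_ ∧f _) ≟F (_ ∨f _) = no λ ()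
  (_ ∧f _) ≟F (_ ⇒ _) = no λ ()
  (_ ∧f _) ≟F (¬f _) = no λ ()
  (_ ⇒ _) ≟F var _ = no λ ()
  (_ ⇒ _) ≟F (_ ∨f _) = no λ ()
  (_ ⇒ _) ≟F (_ ∧f _) = no λ ()
  (_ ⇒ _) ≟F (¬f _) = no λ ()
  (¬f _) ≟F var _ = no λ ()
  (¬f _) ≟F (_ ∨f _) = no λ ()
  (¬f _) ≟F (_ ∧f _) = no λ ()
  (¬f _) ≟F (_ ⇒ _) = no λ ()

  open DecMembership _≟F_ using (_∈?_)

  -- The sequent Γ ⇒ Δ is provable when ⋀Γ ⊢ ⋁Δ.  As ⋁ is not primitive
  -- for lists, this is phrased by elimination: every context extending Γ
  -- derives any C that follows from each member of Δ.  The extension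
  -- quantifier makes provability stable under weakening.
  Provable : List Formula → List Formula → Set
  Provable Γ Δ = ∀ {Γ'} → Γ ⊆ Γ' → ∀ C → (∀ {D} → D ∈ Δ → (D ∷ Γ') ⊢ C) → Γ' ⊢ C

  ∷-mono-⊆ : ∀ {Γ Γ' A} → Γ ⊆ Γ' → (A ∷ Γ) ⊆ (A ∷ Γ')
  ∷-mono-⊆ Γ⊆Γ' (here e) = here e
  ∷-mono-⊆ Γ⊆Γ' (there p) = there (Γ⊆Γ' p)

  ⊆-insert₂ : ∀ {Γ A B} → (A ∷ Γ) ⊆ (A ∷ B ∷ Γ)
  ⊆-insert₂ (here e) = here e
  ⊆-insert₂ (there p) = there (there p)

  ⊆-insert₃ : ∀ {Γ A B C} → (A ∷ Γ) ⊆ (A ∷ B ∷ C ∷ Γ)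
  ⊆-insert₃ (here e) = here e
  ⊆-insert₃ (there p) = there (there (there p))

  -- The rules of a multi-succedent sequent calculus, as closure
  -- properties of Provable; each one is an instance of a Hilbert axiom.
  axiom : ∀ {Γ Δ A} → A ∈ Γ → A ∈ Δ → Provable Γ Δ
  axiom A∈Γ A∈Δ Γ⊆Γ' C k = cut (hyp (Γ⊆Γ' A∈Γ)) (k A∈Δ)

  addLeft : ∀ {Γ Δ A} → (∀ {Γ'} → Γ ⊆ Γ' → Γ' ⊢ A) → Provable (A ∷ Γ) Δ → Provable Γ Δ
  addLeft ⊢A p Γ⊆Γ' C k = cut (⊢A Γ⊆Γ') (p (∷-mono-⊆ Γ⊆Γ') C (λ d → weaken ⊆-insert₂ (k d)))

  addRight : ∀ {Γ Δ A} →
    (∀ {Γ'} → Γ ⊆ Γ' → ∀ C → (∀ {D} → D ∈ Δ → (D ∷ Γ') ⊢ C) → (A ∷ Γ') ⊢ C) →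
    Provable Γ (A ∷ Δ) → Provable Γ Δ
  addRight A⇒C p Γ⊆Γ' C k = p Γ⊆Γ' C λ { (here refl) → A⇒C Γ⊆Γ' C k ; (there d) → k d }

  impliedLeft : ∀ {Γ Δ A E} → IPC⊢ (E ⇒ A) → E ∈ Γ → Provable (A ∷ Γ) Δ → Provable Γ Δ
  impliedLeft E⇒A E∈Γ = addLeft λ Γ⊆Γ' → app (thm E⇒A) (hyp (Γ⊆Γ' E∈Γ))

  impliesRight : ∀ {Γ Δ A E} → IPC⊢ (A ⇒ E) → E ∈ Δ → Provable Γ (A ∷ Δ) → Provable Γ Δ
  impliesRight A⇒E E∈Δ = addRight λ Γ⊆Γ' C k →
    cut (app (thm A⇒E) (hyp (here refl))) (weaken ⊆-insert₂ (k E∈Δ))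

  ∨-left : ∀ {Γ Δ A B} → (A ∨f B) ∈ Γ → Provable (A ∷ Γ) Δ → Provable (B ∷ Γ) Δ → Provable Γ Δ
  ∨-left {A = A} {B} A∨B∈Γ p q Γ⊆Γ' C k =
    app (app (app (thm (ax8 A B C)) (case p)) (case q)) (hyp (Γ⊆Γ' A∨B∈Γ))
    where
      case : ∀ {E} → Provable (E ∷ _) _ → _ ⊢ E ⇒ C
      case r = deduction (r (∷-mono-⊆ Γ⊆Γ') C (λ d → weaken ⊆-insert₂ (k d)))

  ⇒-left : ∀ {Γ Δ A B} → (A ⇒ B) ∈ Γ → Provable Γ (A ∷ Δ) → Provable (B ∷ Γ) Δ → Provable Γ Δ
  ⇒-left A⇒B∈Γ p q Γ⊆Γ' C k = p Γ⊆Γ' C λ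
    { (here refl) → cut (app (hyp (there (Γ⊆Γ' A⇒B∈Γ))) (hyp (here refl)))
                        (q (∷-mono-⊆ (λ x → there (Γ⊆Γ' x))) C (λ d → weaken ⊆-insert₃ (k d)))
    ; (there d) → k d }

  ∧-right : ∀ {Γ Δ A B} → (A ∧f B) ∈ Δ → Provable Γ (A ∷ Δ) → Provable Γ (B ∷ Δ) → Provable Γ Δ
  ∧-right {A = A} {B} A∧B∈Δ p q Γ⊆Γ' C k = p Γ⊆Γ' C λ
    { (here refl) → q (λ x → there (Γ⊆Γ' x)) C λ
        { (here refl) → cut (app (app (thm (ax3 A B)) (hyp (there (here refl)))) (hyp (here refl)))
                            (weaken ⊆-insert₃ (k A∧B∈Δ))
        ; (there d) → weaken ⊆-insert₂ (k d) }
    ; (there d) → k d }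

  -- The intuitionistic right rules for ⇒ and ¬ discard the rest of Δ.
  ⇒-right : ∀ {Γ Δ A B} → (A ⇒ B) ∈ Δ → Provable (A ∷ Γ) (B ∷ []) → Provable Γ Δ
  ⇒-right {B = B} A⇒B∈Δ p Γ⊆Γ' C k =
    cut (deduction (p (∷-mono-⊆ Γ⊆Γ') B λ { (here refl) → hyp (here refl) })) (k A⇒B∈Δ)

  ¬-right : ∀ {Γ Δ A} → (¬f A) ∈ Δ → Provable (A ∷ Γ) [] → Provable Γ Δ
  ¬-right ¬A∈Δ p Γ⊆Γ' C k = cut (¬-intro (p (∷-mono-⊆ Γ⊆Γ') falsum λ ())) (k ¬A∈Δ)

  -- Saturation of a sequent Γ ⇒ Δ: every invertible rule has already
  -- been applied, and no formula occurs on both sides.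
  LeftOk : List Formula → List Formula → Formula → Set
  LeftOk Γ Δ (var n) = Unit.⊤
  LeftOk Γ Δ (A ∨f B) = A ∈ Γ ⊎ B ∈ Γ
  LeftOk Γ Δ (A ∧f B) = A ∈ Γ × B ∈ Γ
  LeftOk Γ Δ (A ⇒ B) = A ∈ Δ ⊎ B ∈ Γ
  LeftOk Γ Δ (¬f A) = A ∈ Δ

  RightOk : List Formula → List Formula → Formula → Set
  RightOk Γ Δ (var n) = Unit.⊤
  RightOk Γ Δ (A ∨f B) = A ∈ Δ × B ∈ Δ
  RightOk Γ Δ (A ∧f B) = A ∈ Δ ⊎ B ∈ Δ
  RightOk Γ Δ (A ⇒ B) = A ∈ Γ → B ∈ Δ
  RightOk Γ Δ (¬f A) = Unit.⊤

  record Saturated (Γ Δ : List Formula) : Set where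
    constructor saturated
    field
      left-ok : ∀ {D} → D ∈ Γ → LeftOk Γ Δ D
      right-ok : ∀ {D} → D ∈ Δ → RightOk Γ Δ D
      disjoint : ∀ {D} → D ∈ Γ → D ∉ Δ

  -- A right formula that needs no successor world in the countermodel:
  -- it is not an implication or negation, or its antecedent already
  -- holds at the current world.
  data Settled (Γ : List Formula) : Formula → Set where
    settled-var : ∀ {n} → Settled Γ (var n)
    settled-∨ : ∀ {A B} → Settled Γ (A ∨f B)
    settled-∧ : ∀ {A B} → Settled Γ (A ∧f B)
    settled-⇒ : ∀ {A B} → A ∈ Γ → Settled Γ (A ⇒ B)
    settled-¬ : ∀ {A} → A ∈ Γ → Settled Γ (¬f A)

  -- A successor world Γ' ⇒ Δ' witnessing that A ⇒ B (resp. ¬A) fails: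
  -- it extends Γ, forces A, and refutes B.
  data ChildFor (Γ : List Formula) : Formula → List Formula → List Formula → Set where
    child-⇒ : ∀ {A B Γ' Δ'} → Γ ⊆ Γ' → A ∈ Γ' → B ∈ Δ' → ChildFor Γ (A ⇒ B) Γ' Δ'
    child-¬ : ∀ {A Γ' Δ'} → Γ ⊆ Γ' → A ∈ Γ' → ChildFor Γ (¬f A) Γ' Δ'

  -- A refutation tree: a saturated root together with one witnessing
  -- subtree for each unsettled right formula, listed in the order of Δ.
  data Refutation (Γ Δ : List Formula) : Set
  data Children (Γ : List Formula) : List Formula → Set

  data Refutation Γ Δ where
    refutation : Saturated Γ Δ → Children Γ Δ → Refutation Γ Δ

  data Children Γ where
    []    : Children Γ []
    skip  : ∀ {D Δ} → Settled Γ D → Children Γ Δ → Children Γ (D ∷ Δ)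
    child : ∀ {D Δ Γ' Δ'} → ChildFor Γ D Γ' Δ' → Refutation Γ' Δ' → Children Γ Δ → Children Γ (D ∷ Δ)

  Refuted : List Formula → List Formula → Set
  Refuted Γ Δ = Σ[ Γ' ∈ List Formula ] Σ[ Δ' ∈ List Formula ] (Γ ⊆ Γ' × Δ ⊆ Δ' × Refutation Γ' Δ')

  Outcome : List Formula → List Formula → Set
  Outcome Γ Δ = Provable Γ Δ ⊎ Refuted Γ Δ

  refuted-∷ˡ : ∀ {Γ Δ A} → Refuted (A ∷ Γ) Δ → Refuted Γ Δ
  refuted-∷ˡ (Γ' , Δ' , Γ⊆Γ' , Δ⊆Δ' , r) = Γ' , Δ' , (λ q → Γ⊆Γ' (there q)) , Δ⊆Δ' , r

  refuted-∷ʳ : ∀ {Γ Δ A} → Refuted Γ (A ∷ Δ) → Refuted Γ Δ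
  refuted-∷ʳ (Γ' , Δ' , Γ⊆Γ' , Δ⊆Δ' , r) = Γ' , Δ' , Γ⊆Γ' , (λ q → Δ⊆Δ' (there q)) , r

  -- Search stays inside a finite universe U closed under immediate
  -- subformulas.
  ImmediateSubformulasIn : List Formula → Formula → Set
  ImmediateSubformulasIn U (var n) = Unit.⊤
  ImmediateSubformulasIn U (A ∨f B) = A ∈ U × B ∈ U
  ImmediateSubformulasIn U (A ∧f B) = A ∈ U × B ∈ U
  ImmediateSubformulasIn U (A ⇒ B) = A ∈ U × B ∈ U
  ImmediateSubformulasIn U (¬f A) = A ∈ U

  SubClosed : List Formula → Set
  SubClosed U = ∀ {D} → D ∈ U → ImmediateSubformulasIn U D

  module Search (U : List Formula) (closedU : SubClosed U) where

    -- Termination measure: the number of formulas of U missing from a side.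
    tick : ∀ {P : Set} → Dec P → ℕ → ℕ
    tick (yes _) n = n
    tick (no _) n = suc n

    missingIn : List Formula → List Formula → ℕ
    missingIn Γ [] = 0
    missingIn Γ (u ∷ us) = tick (u ∈? Γ) (missingIn Γ us)

    missing : List Formula → ℕ
    missing Γ = missingIn Γ U

    tick-≤ : ∀ {P Q : Set} {m n} → (Q → P) → (d : Dec P) (e : Dec Q) → m ≤ n → tick d m ≤ tick e n
    tick-≤ Q⇒P (yes _) (yes _) m≤n = m≤n
    tick-≤ Q⇒P (yes _) (no _) m≤n = NatProps.m≤n⇒m≤1+n m≤n
    tick-≤ Q⇒P (no ¬P) (yes Q) m≤n = ⊥-elim (¬P (Q⇒P Q))
    tick-≤ Q⇒P (no _) (no _) m≤n = s≤s m≤n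

    tick-< : ∀ {P Q : Set} {m n} → (Q → P) → (d : Dec P) (e : Dec Q) → m < n → tick d m < tick e n
    tick-< Q⇒P (yes _) (yes _) m<n = m<n
    tick-< Q⇒P (yes _) (no _) m<n = NatProps.m≤n⇒m≤1+n m<n
    tick-< Q⇒P (no ¬P) (yes Q) m<n = ⊥-elim (¬P (Q⇒P Q))
    tick-< Q⇒P (no _) (no _) m<n = s≤s m<n

    tick-new : ∀ {P Q : Set} {m n} → P → ¬ Q → (d : Dec P) (e : Dec Q) → m ≤ n → tick d m < tick e n
    tick-new P ¬Q (yes _) (no _) m≤n = s≤s m≤n
    tick-new P ¬Q (no ¬P) _ m≤n = ⊥-elim (¬P P)
    tick-new P ¬Q (yes _) (yes Q) m≤n = ⊥-elim (¬Q Q)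

    missing-mono : ∀ {A Γ} us → missingIn (A ∷ Γ) us ≤ missingIn Γ us
    missing-mono [] = z≤n
    missing-mono {A} {Γ} (u ∷ us) = tick-≤ there (u ∈? (A ∷ Γ)) (u ∈? Γ) (missing-mono us)

    missing-decreases : ∀ {A Γ} us → A ∈ us → A ∉ Γ → missingIn (A ∷ Γ) us < missingIn Γ us
    missing-decreases {A} {Γ} (u ∷ us) (here refl) A∉Γ =
      tick-new (here refl) A∉Γ (u ∈? (A ∷ Γ)) (u ∈? Γ) (missing-mono us)
    missing-decreases {A} {Γ} (u ∷ us) (there A∈us) A∉Γ =
      tick-< there (u ∈? (A ∷ Γ)) (u ∈? Γ) (missing-decreases us A∈us A∉Γ)

    data Step (Γ Δ : List Formula) : Set where
      stepClash : ∀ {A} → A ∈ Γ → A ∈ Δ → Step Γ Δ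
      stepLeft : ∀ {A} → A ∈ U → A ∉ Γ → (Provable (A ∷ Γ) Δ → Provable Γ Δ) → Step Γ Δ
      stepRight : ∀ {A} → A ∈ U → A ∉ Δ → (Provable Γ (A ∷ Δ) → Provable Γ Δ) → Step Γ Δ
      stepLeftLeft : ∀ {A B} → A ∈ U → A ∉ Γ → B ∈ U → B ∉ Γ →
        (Provable (A ∷ Γ) Δ → Provable (B ∷ Γ) Δ → Provable Γ Δ) → Step Γ Δ
      stepRightLeft : ∀ {A B} → A ∈ U → A ∉ Δ → B ∈ U → B ∉ Γ →
        (Provable Γ (A ∷ Δ) → Provable (B ∷ Γ) Δ → Provable Γ Δ) → Step Γ Δ
      stepRightRight : ∀ {A B} → A ∈ U → A ∉ Δ → B ∈ U → B ∉ Δ →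
        (Provable Γ (A ∷ Δ) → Provable Γ (B ∷ Δ) → Provable Γ Δ) → Step Γ Δ

    module _ {Γ Δ : List Formula} (Γ⊆U : Γ ⊆ U) (Δ⊆U : Δ ⊆ U) where

      checkLeft : ∀ {D} → D ∈ Γ → Step Γ Δ ⊎ LeftOk Γ Δ D
      checkLeft {var n} p = inj₂ tt
      checkLeft {A ∨f B} p with A ∈? Γ | B ∈? Γ
      ... | yes a | _ = inj₂ (inj₁ a)
      ... | no _ | yes b = inj₂ (inj₂ b)
      ... | no ¬a | no ¬b = inj₁ (stepLeftLeft (proj₁ (closedU (Γ⊆U p))) ¬a (proj₂ (closedU (Γ⊆U p))) ¬b (∨-left p))
      checkLeft {A ∧f B} p with A ∈? Γ | B ∈? Γ
      ... | yes a | yes b = inj₂ (a , b)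
      ... | no ¬a | _ = inj₁ (stepLeft (proj₁ (closedU (Γ⊆U p))) ¬a
                              (impliedLeft (ax4 A B) p))
      ... | yes _ | no ¬b = inj₁ (stepLeft (proj₂ (closedU (Γ⊆U p))) ¬b
                              (impliedLeft (ax5 A B) p))
      checkLeft {A ⇒ B} p with A ∈? Δ | B ∈? Γ
      ... | yes a | _ = inj₂ (inj₁ a)
      ... | no _ | yes b = inj₂ (inj₂ b)
      ... | no ¬a | no ¬b = inj₁ (stepRightLeft (proj₁ (closedU (Γ⊆U p))) ¬a (proj₂ (closedU (Γ⊆U p))) ¬b (⇒-left p))
      checkLeft {¬f A} p with A ∈? Δ
      ... | yes a = inj₂ a
      ... | no ¬a = inj₁ (stepRight (closedU (Γ⊆U p)) ¬a
                       (addRight λ Γ⊆Γ' C k → ¬-elim C (hyp (there (Γ⊆Γ' p))) (hyp (here refl))))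

      checkRight : ∀ {D} → D ∈ Δ → Step Γ Δ ⊎ RightOk Γ Δ D
      checkRight {var n} p = inj₂ tt
      checkRight {A ∨f B} p with A ∈? Δ | B ∈? Δ
      ... | yes a | yes b = inj₂ (a , b)
      ... | no ¬a | _ = inj₁ (stepRight (proj₁ (closedU (Δ⊆U p))) ¬a (impliesRight (ax6 A B) p))
      ... | yes _ | no ¬b = inj₁ (stepRight (proj₂ (closedU (Δ⊆U p))) ¬b (impliesRight (ax7 A B) p))
      checkRight {A ∧f B} p with A ∈? Δ | B ∈? Δ
      ... | yes a | _ = inj₂ (inj₁ a)
      ... | no _ | yes b = inj₂ (inj₂ b)
      ... | no ¬a | no ¬b = inj₁ (stepRightRight (proj₁ (closedU (Δ⊆U p))) ¬a (proj₂ (closedU (Δ⊆U p))) ¬b (∧-right p))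
      checkRight {A ⇒ B} p with A ∈? Γ | B ∈? Δ
      ... | no ¬a | _ = inj₂ (λ a → ⊥-elim (¬a a))
      ... | yes _ | yes b = inj₂ (λ _ → b)
      ... | yes a | no ¬b = inj₁ (stepRight (proj₂ (closedU (Δ⊆U p))) ¬b (impliesRight (ax1 B A) p))
      checkRight {¬f A} p = inj₂ tt

      checkClash : ∀ {D} → D ∈ Γ → Step Γ Δ ⊎ D ∉ Δ
      checkClash {D} p with D ∈? Δ
      ... | yes d = inj₁ (stepClash p d)
      ... | no ¬d = inj₂ ¬d

      scan : ∀ {P : Formula → Set} {X : List Formula} →
             (∀ {D} → D ∈ X → Step Γ Δ ⊎ P D) →
             ∀ xs → xs ⊆ X → Step Γ Δ ⊎ (∀ {D} → D ∈ xs → P D)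
      scan check [] xs⊆X = inj₂ λ ()
      scan check (x ∷ xs) xs⊆X with check (xs⊆X (here refl)) | scan check xs (λ q → xs⊆X (there q))
      ... | inj₁ step | _ = inj₁ step
      ... | inj₂ _ | inj₁ step = inj₁ step
      ... | inj₂ px | inj₂ pxs = inj₂ λ { (here refl) → px ; (there q) → pxs q }

      nextStep : Step Γ Δ ⊎ Saturated Γ Δ
      nextStep with scan checkClash Γ (λ q → q) | scan checkLeft Γ (λ q → q) | scan checkRight Δ (λ q → q)
      ... | inj₁ step | _ | _ = inj₁ step
      ... | inj₂ _ | inj₁ step | _ = inj₁ step
      ... | inj₂ _ | inj₂ _ | inj₁ step = inj₁ step
      ... | inj₂ disj | inj₂ left | inj₂ right = inj₂ (saturated left right disj)

    ∷-⊆ : ∀ {A Γ} → A ∈ U → Γ ⊆ U → (A ∷ Γ) ⊆ U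
    ∷-⊆ A∈U Γ⊆U (here refl) = A∈U
    ∷-⊆ A∈U Γ⊆U (there p) = Γ⊆U p

    liftLeft : ∀ {Γ Δ A} → Outcome (A ∷ Γ) Δ → (Provable (A ∷ Γ) Δ → Provable Γ Δ) → Outcome Γ Δ
    liftLeft (inj₁ p) rule = inj₁ (rule p)
    liftLeft (inj₂ r) rule = inj₂ (refuted-∷ˡ r)

    liftRight : ∀ {Γ Δ A} → Outcome Γ (A ∷ Δ) → (Provable Γ (A ∷ Δ) → Provable Γ Δ) → Outcome Γ Δ
    liftRight (inj₁ p) rule = inj₁ (rule p)
    liftRight (inj₂ r) rule = inj₂ (refuted-∷ʳ r)

    -- Invertible steps grow Γ or Δ inside U; once the
    -- sequent is saturated, every unsettled implication or negation on the
    -- right starts a fresh search for a successor world, which grows Γ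
    -- (and restarts Δ).  Termination is by the pair of missing-counts.
    search : ∀ Γ Δ → Γ ⊆ U → Δ ⊆ U → Acc _<_ (missing Γ) → Acc _<_ (missing Δ) → Outcome Γ Δ
    children : ∀ Γ Δ → Γ ⊆ U → Δ ⊆ U → Acc _<_ (missing Γ) →
      ∀ xs → xs ⊆ Δ → Provable Γ Δ ⊎ Children Γ xs
    childFor : ∀ Γ Δ {xs} → Γ ⊆ U → Δ ⊆ U → Acc _<_ (missing Γ) →
      ∀ x → x ∈ Δ → Children Γ xs → Provable Γ Δ ⊎ Children Γ (x ∷ xs)

    search Γ Δ Γ⊆U Δ⊆U accΓ accΔ with nextStep Γ⊆U Δ⊆U
    search Γ Δ Γ⊆U Δ⊆U accΓ accΔ | inj₁ (stepClash p q) = inj₁ (axiom p q)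
    search Γ Δ Γ⊆U Δ⊆U (acc accΓ) accΔ | inj₁ (stepLeft {A} u ¬a rule) =
      liftLeft (search (A ∷ Γ) Δ (∷-⊆ u Γ⊆U) Δ⊆U (accΓ (missing-decreases U u ¬a)) accΔ) rule
    search Γ Δ Γ⊆U Δ⊆U accΓ (acc accΔ) | inj₁ (stepRight {A} u ¬a rule) =
      liftRight (search Γ (A ∷ Δ) Γ⊆U (∷-⊆ u Δ⊆U) accΓ (accΔ (missing-decreases U u ¬a))) rule
    search Γ Δ Γ⊆U Δ⊆U (acc accΓ) accΔ | inj₁ (stepLeftLeft {A} {B} u ¬a v ¬b rule)
      with search (A ∷ Γ) Δ (∷-⊆ u Γ⊆U) Δ⊆U (accΓ (missing-decreases U u ¬a)) accΔ
    ... | inj₂ r = inj₂ (refuted-∷ˡ r)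
    ... | inj₁ p = liftLeft (search (B ∷ Γ) Δ (∷-⊆ v Γ⊆U) Δ⊆U (accΓ (missing-decreases U v ¬b)) accΔ) (rule p)
    search Γ Δ Γ⊆U Δ⊆U (acc accΓ) (acc accΔ) | inj₁ (stepRightLeft {A} {B} u ¬a v ¬b rule)
      with search Γ (A ∷ Δ) Γ⊆U (∷-⊆ u Δ⊆U) (acc accΓ) (accΔ (missing-decreases U u ¬a))
    ... | inj₂ r = inj₂ (refuted-∷ʳ r)
    ... | inj₁ p = liftLeft (search (B ∷ Γ) Δ (∷-⊆ v Γ⊆U) Δ⊆U (accΓ (missing-decreases U v ¬b)) (acc accΔ)) (rule p)
    search Γ Δ Γ⊆U Δ⊆U accΓ (acc accΔ) | inj₁ (stepRightRight {A} {B} u ¬a v ¬b rule)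
      with search Γ (A ∷ Δ) Γ⊆U (∷-⊆ u Δ⊆U) accΓ (accΔ (missing-decreases U u ¬a))
    ... | inj₂ r = inj₂ (refuted-∷ʳ r)
    ... | inj₁ p = liftRight (search Γ (B ∷ Δ) Γ⊆U (∷-⊆ v Δ⊆U) accΓ (accΔ (missing-decreases U v ¬b))) (rule p)
    search Γ Δ Γ⊆U Δ⊆U accΓ accΔ | inj₂ sat with children Γ Δ Γ⊆U Δ⊆U accΓ Δ (λ q → q)
    ... | inj₁ p = inj₁ p
    ... | inj₂ ks = inj₂ (Γ , Δ , (λ q → q) , (λ q → q) , refutation sat ks)

    children Γ Δ Γ⊆U Δ⊆U accΓ [] xs⊆Δ = inj₂ []
    children Γ Δ Γ⊆U Δ⊆U accΓ (x ∷ xs) xs⊆Δ with children Γ Δ Γ⊆U Δ⊆U accΓ xs (λ q → xs⊆Δ (there q))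
    ... | inj₁ p = inj₁ p
    ... | inj₂ ks = childFor Γ Δ Γ⊆U Δ⊆U accΓ x (xs⊆Δ (here refl)) ks

    childFor Γ Δ Γ⊆U Δ⊆U accΓ (var n) p ks = inj₂ (skip settled-var ks)
    childFor Γ Δ Γ⊆U Δ⊆U accΓ (A ∨f B) p ks = inj₂ (skip settled-∨ ks)
    childFor Γ Δ Γ⊆U Δ⊆U accΓ (A ∧f B) p ks = inj₂ (skip settled-∧ ks)
    childFor Γ Δ Γ⊆U Δ⊆U accΓ (A ⇒ B) p ks with A ∈? Γ
    ... | yes a = inj₂ (skip (settled-⇒ a) ks)
    childFor Γ Δ Γ⊆U Δ⊆U (acc accΓ) (A ⇒ B) p ks | no ¬a
      with search (A ∷ Γ) (B ∷ []) (∷-⊆ (proj₁ (closedU (Δ⊆U p))) Γ⊆U)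
             (∷-⊆ (proj₂ (closedU (Δ⊆U p))) (λ ()))
             (accΓ (missing-decreases U (proj₁ (closedU (Δ⊆U p))) ¬a)) (<-wellFounded _)
    ... | inj₁ pr = inj₁ (⇒-right p pr)
    ... | inj₂ (Γ' , Δ' , Γ⊆Γ' , Δ⊆Δ' , r) =
          inj₂ (child (child-⇒ (λ q → Γ⊆Γ' (there q)) (Γ⊆Γ' (here refl)) (Δ⊆Δ' (here refl))) r ks)
    childFor Γ Δ Γ⊆U Δ⊆U accΓ (¬f A) p ks with A ∈? Γ
    ... | yes a = inj₂ (skip (settled-¬ a) ks)
    childFor Γ Δ Γ⊆U Δ⊆U (acc accΓ) (¬f A) p ks | no ¬a
      with search (A ∷ Γ) [] (∷-⊆ (closedU (Δ⊆U p)) Γ⊆U) (λ ())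
             (accΓ (missing-decreases U (closedU (Δ⊆U p)) ¬a)) (<-wellFounded _)
    ... | inj₁ pr = inj₁ (¬-right p pr)
    ... | inj₂ (Γ' , Δ' , Γ⊆Γ' , Δ⊆Δ' , r) =
          inj₂ (child (child-¬ (λ q → Γ⊆Γ' (there q)) (Γ⊆Γ' (here refl))) r ks)

  subs : Formula → List Formula
  subs (var n) = var n ∷ []
  subs (A ∨f B) = (A ∨f B) ∷ (subs A ++ subs B)
  subs (A ∧f B) = (A ∧f B) ∷ (subs A ++ subs B)
  subs (A ⇒ B) = (A ⇒ B) ∷ (subs A ++ subs B)
  subs (¬f A) = (¬f A) ∷ subs A

  subs-self : ∀ A → A ∈ subs A
  subs-self (var n) = here refl
  subs-self (A ∨f B) = here refl
  subs-self (A ∧f B) = here refl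
  subs-self (A ⇒ B) = here refl
  subs-self (¬f A) = here refl

  subs-trans : ∀ φ {D} → D ∈ subs φ → subs D ⊆ subs φ
  subs-trans₂ : ∀ A B {D} → D ∈ subs A ++ subs B → subs D ⊆ (subs A ++ subs B)

  subs-trans (var n) (here refl) q = q
  subs-trans (A ∨f B) (here refl) q = q
  subs-trans (A ∧f B) (here refl) q = q
  subs-trans (A ⇒ B) (here refl) q = q
  subs-trans (¬f A) (here refl) q = q
  subs-trans (A ∨f B) (there p) q = there (subs-trans₂ A B p q)
  subs-trans (A ∧f B) (there p) q = there (subs-trans₂ A B p q)
  subs-trans (A ⇒ B) (there p) q = there (subs-trans₂ A B p q)
  subs-trans (¬f A) (there p) q = there (subs-trans A p q)

  subs-trans₂ A B p q with ∈-++⁻ (subs A) p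
  ... | inj₁ a = ∈-++⁺ˡ (subs-trans A a q)
  ... | inj₂ b = ∈-++⁺ʳ (subs A) (subs-trans B b q)

  subs-binary : ∀ φ {C} A B → C ∈ subs φ → subs C ≡ C ∷ (subs A ++ subs B) → A ∈ subs φ × B ∈ subs φ
  subs-binary φ {C} A B C∈φ eq =
      subs-trans φ C∈φ (subst (A ∈_) (sym eq) (there (∈-++⁺ˡ (subs-self A))))
    , subs-trans φ C∈φ (subst (B ∈_) (sym eq) (there (∈-++⁺ʳ (subs A) (subs-self B))))

  subs-closed : ∀ φ → SubClosed (subs φ)
  subs-closed φ {var n} p = tt
  subs-closed φ {A ∨f B} p = subs-binary φ A B p refl
  subs-closed φ {A ∧f B} p = subs-binary φ A B p refl
  subs-closed φ {A ⇒ B} p = subs-binary φ A B p refl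
  subs-closed φ {¬f A} p = subs-trans φ p (there (subs-self A))

  decide : ∀ φ → IPC⊢ φ ⊎ Σ[ Γ ∈ List Formula ] Σ[ Δ ∈ List Formula ] (φ ∈ Δ × Refutation Γ Δ)
  decide φ with Search.search (subs φ) (subs-closed φ) [] (φ ∷ []) (λ ())
                  (λ { (here refl) → subs-self φ }) (<-wellFounded _) (<-wellFounded _)
  ... | inj₁ p = inj₁ (closed (p (λ q → q) φ λ { (here refl) → hyp (here refl) }))
  ... | inj₂ (Γ , Δ , _ , φ∈Δ , r) = inj₂ (Γ , Δ , φ∈Δ (here refl) , r)
-- The Heyting algebra of up-sets of a finite rooted tree.

-- An up-set of the tree
-- (ordered with the root at the bottom) either contains the root, and is
-- then the whole tree ('all'), or consists of an up-set of every subtree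
-- ('sub').  Up-sets of a forest are tuples of up-sets of its trees; all
-- operations on them are componentwise.  These are the truth-value
-- algebras of Kripke models on finite trees.

module UpSets where

  mutual
    data Tree : Set where
      node : Forest → Tree
    data Forest : Set where
      []   : Forest
      branch : Tree → Forest → Forest

  mutual
    data Up : Tree → Set where
      all : ∀ {t} → Up t
      sub : ∀ {k} → UpK k → Up (node k)
    data UpK : Forest → Set where
      []   : UpK []
      _∷_  : ∀ {t k} → Up t → UpK k → UpK (branch t k)

  infixr 5 _∷_

  mutual
    botU : ∀ t → Up t
    botU (node k) = sub (botK k)
    botK : ∀ k → UpK k
    botK [] = []
    botK (branch t k) = botU t ∷ botK k

  topK : ∀ k → UpK k
  topK [] = []
  topK (branch t k) = all ∷ topK k

  mutual
    _∪_ : ∀ {t} → Up t → Up t → Up t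
    all ∪ v = all
    sub x ∪ all = all
    sub x ∪ sub y = sub (x ∪K y)
    _∪K_ : ∀ {k} → UpK k → UpK k → UpK k
    [] ∪K [] = []
    (u ∷ x) ∪K (v ∷ y) = (u ∪ v) ∷ (x ∪K y)

  mutual
    _∩_ : ∀ {t} → Up t → Up t → Up t
    all ∩ v = v
    sub x ∩ all = sub x
    sub x ∩ sub y = sub (x ∩K y)
    _∩K_ : ∀ {k} → UpK k → UpK k → UpK k
    [] ∩K [] = []
    (u ∷ x) ∩K (v ∷ y) = (u ∩ v) ∷ (x ∩K y)

  -- The implication of
  -- two rootless up-sets contains the root exactly when the componentwise
  -- implication is the whole forest, and 'norm' then returns the whole tree.
  data AllK : ∀ {k} → UpK k → Set where
    []   : AllK []
    cons : ∀ {t k} {x : UpK k} → AllK x → AllK (all {t} ∷ x)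

  allK? : ∀ {k} (x : UpK k) → Dec (AllK x)
  allK? [] = yes []
  allK? (all ∷ x) with allK? x
  ... | yes a = yes (cons a)
  ... | no na = no λ { (cons a) → na a }
  allK? (sub _ ∷ x) = no λ ()

  norm : ∀ {k} (x : UpK k) → Dec (AllK x) → Up (node k)
  norm x (yes _) = all
  norm x (no _) = sub x

  mutual
    _⇨_ : ∀ {t} → Up t → Up t → Up t
    all ⇨ v = v
    sub x ⇨ all = all
    sub x ⇨ sub y = norm (x ⇨K y) (allK? (x ⇨K y))
    _⇨K_ : ∀ {k} → UpK k → UpK k → UpK k
    [] ⇨K [] = []
    (u ∷ x) ⇨K (v ∷ y) = (u ⇨ v) ∷ (x ⇨K y)

  mutual
    data _⊑_ : ∀ {t} → Up t → Up t → Set where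
      ⊑all : ∀ {t} {u : Up t} → u ⊑ all
      ⊑sub : ∀ {k} {x y : UpK k} → x ⊑K y → sub x ⊑ sub y
    data _⊑K_ : ∀ {k} → UpK k → UpK k → Set where
      []   : [] ⊑K []
      _∷_  : ∀ {t k} {u v : Up t} {x y : UpK k} → u ⊑ v → x ⊑K y → (u ∷ x) ⊑K (v ∷ y)

  mutual
    ⊑-refl : ∀ {t} (u : Up t) → u ⊑ u
    ⊑-refl all = ⊑all
    ⊑-refl (sub x) = ⊑sub (⊑K-refl x)
    ⊑K-refl : ∀ {k} (x : UpK k) → x ⊑K x
    ⊑K-refl [] = []
    ⊑K-refl (u ∷ x) = ⊑-refl u ∷ ⊑K-refl x

  mutual
    ⊑-trans : ∀ {t} {u v w : Up t} → u ⊑ v → v ⊑ w → u ⊑ w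
    ⊑-trans p ⊑all = ⊑all
    ⊑-trans (⊑sub p) (⊑sub q) = ⊑sub (⊑K-trans p q)
    ⊑K-trans : ∀ {k} {x y z : UpK k} → x ⊑K y → y ⊑K z → x ⊑K z
    ⊑K-trans [] [] = []
    ⊑K-trans (p ∷ p') (q ∷ q') = ⊑-trans p q ∷ ⊑K-trans p' q'

  mutual
    ⊑-antisym : ∀ {t} {u v : Up t} → u ⊑ v → v ⊑ u → u ≡ v
    ⊑-antisym ⊑all ⊑all = refl
    ⊑-antisym (⊑sub p) (⊑sub q) = cong sub (⊑K-antisym p q)
    ⊑K-antisym : ∀ {k} {x y : UpK k} → x ⊑K y → y ⊑K x → x ≡ y
    ⊑K-antisym [] [] = refl
    ⊑K-antisym (p ∷ p') (q ∷ q') = cong₂ _∷_ (⊑-antisym p q) (⊑K-antisym p' q')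

  mutual
    ∪-l : ∀ {t} (u v : Up t) → u ⊑ (u ∪ v)
    ∪-l all v = ⊑all
    ∪-l (sub x) all = ⊑all
    ∪-l (sub x) (sub y) = ⊑sub (∪K-l x y)
    ∪K-l : ∀ {k} (x y : UpK k) → x ⊑K (x ∪K y)
    ∪K-l [] [] = []
    ∪K-l (u ∷ x) (v ∷ y) = ∪-l u v ∷ ∪K-l x y

  mutual
    ∪-r : ∀ {t} (u v : Up t) → v ⊑ (u ∪ v)
    ∪-r all v = ⊑all
    ∪-r (sub x) all = ⊑all
    ∪-r (sub x) (sub y) = ⊑sub (∪K-r x y)
    ∪K-r : ∀ {k} (x y : UpK k) → y ⊑K (x ∪K y)
    ∪K-r [] [] = []
    ∪K-r (u ∷ x) (v ∷ y) = ∪-r u v ∷ ∪K-r x y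

  mutual
    ∪-least : ∀ {t} {u v w : Up t} → u ⊑ w → v ⊑ w → (u ∪ v) ⊑ w
    ∪-least p ⊑all = ⊑all
    ∪-least (⊑sub p) (⊑sub q) = ⊑sub (∪K-least p q)
    ∪K-least : ∀ {k} {x y z : UpK k} → x ⊑K z → y ⊑K z → (x ∪K y) ⊑K z
    ∪K-least [] [] = []
    ∪K-least (p ∷ p') (q ∷ q') = ∪-least p q ∷ ∪K-least p' q'

  mutual
    ∩-l : ∀ {t} (u v : Up t) → (u ∩ v) ⊑ u
    ∩-l all v = ⊑all
    ∩-l (sub x) all = ⊑-refl (sub x)
    ∩-l (sub x) (sub y) = ⊑sub (∩K-l x y)
    ∩K-l : ∀ {k} (x y : UpK k) → (x ∩K y) ⊑K x
    ∩K-l [] [] = []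
    ∩K-l (u ∷ x) (v ∷ y) = ∩-l u v ∷ ∩K-l x y

  mutual
    ∩-r : ∀ {t} (u v : Up t) → (u ∩ v) ⊑ v
    ∩-r all v = ⊑-refl v
    ∩-r (sub x) all = ⊑all
    ∩-r (sub x) (sub y) = ⊑sub (∩K-r x y)
    ∩K-r : ∀ {k} (x y : UpK k) → (x ∩K y) ⊑K y
    ∩K-r [] [] = []
    ∩K-r (u ∷ x) (v ∷ y) = ∩-r u v ∷ ∩K-r x y

  mutual
    ∩-greatest : ∀ {t} {u v w : Up t} → w ⊑ u → w ⊑ v → w ⊑ (u ∩ v)
    ∩-greatest {u = all} p q = q
    ∩-greatest {u = sub x} {all} p q = p
    ∩-greatest {u = sub x} {sub y} (⊑sub p) (⊑sub q) = ⊑sub (∩K-greatest p q)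
    ∩K-greatest : ∀ {k} {x y z : UpK k} → z ⊑K x → z ⊑K y → z ⊑K (x ∩K y)
    ∩K-greatest [] [] = []
    ∩K-greatest (p ∷ p') (q ∷ q') = ∩-greatest p q ∷ ∩K-greatest p' q'

  mutual
    bot-min : ∀ t (u : Up t) → botU t ⊑ u
    bot-min t all = ⊑all
    bot-min (node k) (sub x) = ⊑sub (botK-min k x)
    botK-min : ∀ k (x : UpK k) → botK k ⊑K x
    botK-min [] [] = []
    botK-min (branch t k) (u ∷ x) = bot-min t u ∷ botK-min k x

  all⊑ : ∀ {t} {u : Up t} → all ⊑ u → u ≡ all
  all⊑ ⊑all = refl

  mutual
    ⇨≡all⇒⊑ : ∀ {t} (u v : Up t) → (u ⇨ v) ≡ all → u ⊑ v
    ⇨≡all⇒⊑ all v e rewrite e = ⊑all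
    ⇨≡all⇒⊑ (sub x) all e = ⊑all
    ⇨≡all⇒⊑ (sub x) (sub y) e with allK? (x ⇨K y)
    ... | yes a = ⊑sub (allK⇒⊑K x y a)
    ... | no _ with e
    ... | ()
    allK⇒⊑K : ∀ {k} (x y : UpK k) → AllK (x ⇨K y) → x ⊑K y
    allK⇒⊑K [] [] a = []
    allK⇒⊑K (u ∷ x) (v ∷ y) a with u ⇨ v in eq
    allK⇒⊑K (u ∷ x) (v ∷ y) (cons a) | all = ⇨≡all⇒⊑ u v eq ∷ allK⇒⊑K x y a

  mutual
    ⊑⇒⇨≡all : ∀ {t} {u v : Up t} → u ⊑ v → (u ⇨ v) ≡ all
    ⊑⇒⇨≡all {u = all} ⊑all = refl
    ⊑⇒⇨≡all {u = sub x} ⊑all = refl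
    ⊑⇒⇨≡all (⊑sub {x = x} {y} p) with allK? (x ⇨K y)
    ... | yes _ = refl
    ... | no na = ⊥-elim (na (⊑K⇒allK p))
    ⊑K⇒allK : ∀ {k} {x y : UpK k} → x ⊑K y → AllK (x ⇨K y)
    ⊑K⇒allK [] = []
    ⊑K⇒allK (_∷_ {u = u} {v} p q) with u ⇨ v | ⊑⇒⇨≡all p
    ... | .all | refl = cons (⊑K⇒allK q)

  mutual
    curry⊑ : ∀ {t} (w x y : Up t) → (w ∩ x) ⊑ y → w ⊑ (x ⇨ y)
    curry⊑ all all y p = p
    curry⊑ (sub w) all y p = p
    curry⊑ w (sub x) all p = ⊑all
    curry⊑ all (sub x) (sub y) (⊑sub p) with allK? (x ⇨K y)
    ... | yes _ = ⊑all
    ... | no na = ⊥-elim (na (⊑K⇒allK p))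
    curry⊑ (sub w) (sub x) (sub y) (⊑sub p) with allK? (x ⇨K y)
    ... | yes _ = ⊑all
    ... | no na = ⊑sub (curryK⊑ w x y p)
    curryK⊑ : ∀ {k} (w x y : UpK k) → (w ∩K x) ⊑K y → w ⊑K (x ⇨K y)
    curryK⊑ [] [] [] p = []
    curryK⊑ (a ∷ w) (b ∷ x) (c ∷ y) (p ∷ q) = curry⊑ a b c p ∷ curryK⊑ w x y q

  mutual
    uncurry⊑ : ∀ {t} (w x y : Up t) → w ⊑ (x ⇨ y) → (w ∩ x) ⊑ y
    uncurry⊑ all all y p = p
    uncurry⊑ (sub w) all y p = p
    uncurry⊑ w (sub x) all p = ⊑all
    uncurry⊑ w (sub x) (sub y) p with allK? (x ⇨K y)
    uncurry⊑ all (sub x) (sub y) p | yes a = ⊑sub (allK⇒⊑K x y a)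
    uncurry⊑ (sub w) (sub x) (sub y) p | yes a = ⊑sub (⊑K-trans (∩K-r w x) (allK⇒⊑K x y a))
    uncurry⊑ (sub w) (sub x) (sub y) (⊑sub p) | no na = ⊑sub (uncurryK⊑ w x y p)
    uncurryK⊑ : ∀ {k} (w x y : UpK k) → w ⊑K (x ⇨K y) → (w ∩K x) ⊑K y
    uncurryK⊑ [] [] [] p = []
    uncurryK⊑ (a ∷ w) (b ∷ x) (c ∷ y) (p ∷ q) = uncurry⊑ a b c p ∷ uncurryK⊑ w x y q

  upSets-isHeytingAlgebra : ∀ t → IsHeytingAlgebra _≡_ (_⊑_ {t}) _∪_ _∩_ _⇨_ all (botU t)
  upSets-isHeytingAlgebra t = record
    { isBoundedLattice = record
      { isLattice = record
        { isPartialOrder = record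
          { isPreorder = record
            { isEquivalence = ≡.isEquivalence
            ; reflexive = λ { refl → ⊑-refl _ }
            ; trans = ⊑-trans }
          ; antisym = ⊑-antisym }
        ; supremum = λ x y → ∪-l x y , ∪-r x y , λ z → ∪-least
        ; infimum = λ x y → ∩-l x y , ∩-r x y , λ z → ∩-greatest }
      ; maximum = λ x → ⊑all
      ; minimum = bot-min t }
    ; exponential = λ w x y → curry⊑ w x y , uncurry⊑ w x y }

  upSets : Tree → HeytingAlgebra 0ℓ 0ℓ 0ℓ
  upSets t = record { isHeytingAlgebra = upSets-isHeytingAlgebra t }

  mutual
    enum : ∀ t → List (Up t)
    enum (node k) = all ∷ map sub (enumK k)
    enumK : ∀ k → List (UpK k)
    enumK [] = [] ∷ []
    enumK (branch t k) = cartesianProductWith _∷_ (enum t) (enumK k)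

  mutual
    enum-complete : ∀ t (u : Up t) → u ∈ enum t
    enum-complete (node k) all = here refl
    enum-complete (node k) (sub x) = there (∈-map⁺ sub (enumK-complete k x))
    enumK-complete : ∀ k (x : UpK k) → x ∈ enumK k
    enumK-complete [] [] = here refl
    enumK-complete (branch t k) (u ∷ x) =
      ∈-cartesianProductWith⁺ _∷_ (enum-complete t u) (enumK-complete k x)

  upSets-finite : ∀ t → Finite (Up t) _≡_
  upSets-finite t = length (enum t) , lookup (enum t) ,
    λ u → index (enum-complete t u) , sym (lookup-index (enum-complete t u))

  restrict : ∀ {k} → Up (node k) → UpK k
  restrict all = topK _
  restrict (sub x) = x

  ∪all : ∀ {t} (u : Up t) → (u ∪ all) ≡ all
  ∪all all = refl
  ∪all (sub x) = refl

  ∩all : ∀ {t} (u : Up t) → (u ∩ all) ≡ u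
  ∩all all = refl
  ∩all (sub x) = refl

  ⇨all : ∀ {t} (u : Up t) → (u ⇨ all) ≡ all
  ⇨all all = refl
  ⇨all (sub x) = refl

  topK∪ : ∀ {k} (x : UpK k) → (topK k ∪K x) ≡ topK k
  topK∪ [] = refl
  topK∪ (u ∷ x) = cong (all ∷_) (topK∪ x)

  ∪topK : ∀ {k} (x : UpK k) → (x ∪K topK k) ≡ topK k
  ∪topK [] = refl
  ∪topK (u ∷ x) = cong₂ _∷_ (∪all u) (∪topK x)

  topK∩ : ∀ {k} (x : UpK k) → (topK k ∩K x) ≡ x
  topK∩ [] = refl
  topK∩ (u ∷ x) = cong (u ∷_) (topK∩ x)

  ∩topK : ∀ {k} (x : UpK k) → (x ∩K topK k) ≡ x
  ∩topK [] = refl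
  ∩topK (u ∷ x) = cong₂ _∷_ (∩all u) (∩topK x)

  topK⇨ : ∀ {k} (x : UpK k) → (topK k ⇨K x) ≡ x
  topK⇨ [] = refl
  topK⇨ (u ∷ x) = cong (u ∷_) (topK⇨ x)

  ⇨topK : ∀ {k} (x : UpK k) → (x ⇨K topK k) ≡ topK k
  ⇨topK [] = refl
  ⇨topK (u ∷ x) = cong₂ _∷_ (⇨all u) (⇨topK x)

  allK≡ : ∀ {k} {x : UpK k} → AllK x → x ≡ topK k
  allK≡ [] = refl
  allK≡ (cons a) = cong (all ∷_) (allK≡ a)

  restrict-norm : ∀ {k} (x : UpK k) (d : Dec (AllK x)) → restrict (norm x d) ≡ x
  restrict-norm x (yes a) = sym (allK≡ a)
  restrict-norm x (no _) = refl

  restrict-∪ : ∀ {k} (u v : Up (node k)) → restrict (u ∪ v) ≡ (restrict u ∪K restrict v)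
  restrict-∪ all v = sym (topK∪ _)
  restrict-∪ (sub x) all = sym (∪topK x)
  restrict-∪ (sub x) (sub y) = refl

  restrict-∩ : ∀ {k} (u v : Up (node k)) → restrict (u ∩ v) ≡ (restrict u ∩K restrict v)
  restrict-∩ all v = sym (topK∩ _)
  restrict-∩ (sub x) all = sym (∩topK x)
  restrict-∩ (sub x) (sub y) = refl

  restrict-⇨ : ∀ {k} (u v : Up (node k)) → restrict (u ⇨ v) ≡ (restrict u ⇨K restrict v)
  restrict-⇨ all v = sym (topK⇨ _)
  restrict-⇨ (sub x) all = sym (⇨topK x)
  restrict-⇨ (sub x) (sub y) = restrict-norm (x ⇨K y) (allK? (x ⇨K y))

  nil⊑ : (x y : UpK []) → x ⊑K y
  nil⊑ [] [] = []

  ⊑-node : ∀ {k} {u v : Up (node k)} → (u ≡ all → v ≡ all) → restrict u ⊑K restrict v → u ⊑ v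
  ⊑-node {u = u} {all} h p = ⊑all
  ⊑-node {u = all} {sub y} h p with h refl
  ... | ()
  ⊑-node {u = sub x} {sub y} h p = ⊑sub p

  topK⊑ : ∀ {k} (x : UpK k) → x ⊑K topK k
  topK⊑ [] = []
  topK⊑ (u ∷ x) = ⊑all ∷ topK⊑ x

  restrict-mono : ∀ {k} {u v : Up (node k)} → u ⊑ v → restrict u ⊑K restrict v
  restrict-mono {u = u} ⊑all = topK⊑ (restrict u)
  restrict-mono (⊑sub p) = p

  all⊑sub : ∀ {k} {x : UpK k} → all ⊑ sub x → Empty.⊥
  all⊑sub ()

  ∩≡all : ∀ {t} (u v : Up t) → (u ∩ v) ≡ all → (u ≡ all) × (v ≡ all)
  ∩≡all all v e = refl , e
  ∩≡all (sub x) all ()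
  ∩≡all (sub x) (sub y) ()

  ∪≡all : ∀ {t} (u v : Up t) → (u ∪ v) ≡ all → (u ≡ all) ⊎ (v ≡ all)
  ∪≡all all v e = inj₁ refl
  ∪≡all (sub x) all e = inj₂ refl
  ∪≡all (sub x) (sub y) ()

  tl⊑ : ∀ {t k} {u v : Up t} {x y : UpK k} → (u ∷ x) ⊑K (v ∷ y) → x ⊑K y
  tl⊑ (_ ∷ p) = p

  ∪-idem : ∀ {t} (u : Up t) → (u ∪ u) ≡ u
  ∪-idem u = ⊑-antisym (∪-least (⊑-refl u) (⊑-refl u)) (∪-l u u)
  ∩-idem : ∀ {t} (u : Up t) → (u ∩ u) ≡ u
  ∩-idem u = ⊑-antisym (∩-l u u) (∩-greatest (⊑-refl u) (⊑-refl u))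
  ∪K-idem : ∀ {k} (x : UpK k) → (x ∪K x) ≡ x
  ∪K-idem x = ⊑K-antisym (∪K-least (⊑K-refl x) (⊑K-refl x)) (∪K-l x x)
  ∩K-idem : ∀ {k} (x : UpK k) → (x ∩K x) ≡ x
  ∩K-idem x = ⊑K-antisym (∩K-l x x) (∩K-greatest (⊑K-refl x) (⊑K-refl x))
  ∪bot : ∀ t (u : Up t) → (u ∪ botU t) ≡ u
  ∪bot t u = ⊑-antisym (∪-least (⊑-refl u) (bot-min t u)) (∪-l u _)
  botK∪ : ∀ k (x : UpK k) → (botK k ∪K x) ≡ x
  botK∪ k x = ⊑K-antisym (∪K-least (botK-min k x) (⊑K-refl x)) (∪K-r _ x)

-- The truth lemma: a refutation tree is a Kripke countermodel.

-- The tree of a refutation is its frame, and a variable holds at a world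
-- when it occurs in the left side of that world's sequent.  Evaluating in
-- the up-set algebra, every left formula of the root is true (the whole
-- tree) and no right formula is; in particular the goal is refuted.

module TruthLemma where
  open Hilbert using (_⊆_)
  open ProofSearch
  open UpSets

  open DecMembership _≟F_ using (_∈?_)

  mutual
    shape : ∀ {Γ Δ} → Refutation Γ Δ → Tree
    shape (refutation s ks) = node (shapeK ks)
    shapeK : ∀ {Γ Δ} → Children Γ Δ → Forest
    shapeK [] = []
    shapeK (skip _ ks) = shapeK ks
    shapeK (child _ r ks) = branch (shape r) (shapeK ks)

  rootValue : ∀ {P : Set} {k} → Dec P → UpK k → Up (node k)
  rootValue (yes _) x = all
  rootValue (no _) x = sub x

  mutual
    valuation : ∀ {Γ Δ} (r : Refutation Γ Δ) → ℕ → Up (shape r)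
    valuation {Γ} (refutation s ks) n = rootValue (var n ∈? Γ) (valuationK ks n)
    valuationK : ∀ {Γ Δ} (ks : Children Γ Δ) → ℕ → UpK (shapeK ks)
    valuationK [] n = []
    valuationK (skip _ ks) n = valuationK ks n
    valuationK (child _ r ks) n = valuation r n ∷ valuationK ks n

  childFor-⊆ : ∀ {Γ D Γ' Δ'} → ChildFor Γ D Γ' Δ' → Γ ⊆ Γ'
  childFor-⊆ (child-⇒ s _ _) = s
  childFor-⊆ (child-¬ s _) = s

  mutual
    valuation-all : ∀ {Γ Δ n} (r : Refutation Γ Δ) → var n ∈ Γ → valuation r n ≡ all
    valuation-all {Γ} {n = n} (refutation s ks) p with var n ∈? Γ
    ... | yes _ = refl
    ... | no np = ⊥-elim (np p)
    valuationK-top : ∀ {Γ Δ n} (ks : Children Γ Δ) → var n ∈ Γ → valuationK ks n ≡ topK (shapeK ks)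
    valuationK-top [] p = refl
    valuationK-top (skip _ ks) p = valuationK-top ks p
    valuationK-top (child c r ks) p = cong₂ _∷_ (valuation-all r (childFor-⊆ c p)) (valuationK-top ks p)

  restrict-valuation : ∀ {Γ Δ n} (s : Saturated Γ Δ) (ks : Children Γ Δ) →
    restrict (valuation (refutation s ks) n) ≡ valuationK ks n
  restrict-valuation {Γ} {n = n} s ks with var n ∈? Γ
  ... | yes p = sym (valuationK-top ks p)
  ... | no _ = refl

  evK : ∀ {k} → Formula → (ℕ → UpK k) → UpK k
  evK (var n) w = w n
  evK (A ∨f B) w = evK A w ∪K evK B w
  evK (A ∧f B) w = evK A w ∩K evK B w
  evK (A ⇒ B) w = evK A w ⇨K evK B w
  evK {k} (¬f A) w = evK A w ⇨K botK k

  ev : ∀ {t} → Formula → (ℕ → Up t) → Up t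
  ev {t} A v = ⟦_⟧H (upSets t) A v

  restrict-ev : ∀ {k} ψ (v : ℕ → Up (node k)) → restrict (ev ψ v) ≡ evK ψ (λ n → restrict (v n))
  restrict-ev (var n) v = refl
  restrict-ev (A ∨f B) v = ≡.trans (restrict-∪ (ev A v) (ev B v)) (cong₂ _∪K_ (restrict-ev A v) (restrict-ev B v))
  restrict-ev (A ∧f B) v = ≡.trans (restrict-∩ (ev A v) (ev B v)) (cong₂ _∩K_ (restrict-ev A v) (restrict-ev B v))
  restrict-ev (A ⇒ B) v = ≡.trans (restrict-⇨ (ev A v) (ev B v)) (cong₂ _⇨K_ (restrict-ev A v) (restrict-ev B v))
  restrict-ev {k} (¬f A) v = ≡.trans (restrict-⇨ (ev A v) (botU (node k))) (cong (_⇨K botK k) (restrict-ev A v))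

  evK-ext : ∀ {k} ψ {v w : ℕ → UpK k} → (∀ n → v n ≡ w n) → evK ψ v ≡ evK ψ w
  evK-ext (var n) e = e n
  evK-ext (A ∨f B) e = cong₂ _∪K_ (evK-ext A e) (evK-ext B e)
  evK-ext (A ∧f B) e = cong₂ _∩K_ (evK-ext A e) (evK-ext B e)
  evK-ext (A ⇒ B) e = cong₂ _⇨K_ (evK-ext A e) (evK-ext B e)
  evK-ext (¬f A) e = cong (_⇨K _) (evK-ext A e)

  hdK : ∀ {t k} → UpK (branch t k) → Up t
  hdK (u ∷ x) = u
  tlK : ∀ {t k} → UpK (branch t k) → UpK k
  tlK (u ∷ x) = x

  evK-branch : ∀ {t k} ψ (w : ℕ → UpK (branch t k)) →
    evK ψ w ≡ (ev ψ (λ n → hdK (w n)) ∷ evK ψ (λ n → tlK (w n)))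
  evK-branch (var n) w with w n
  ... | u ∷ x = refl
  evK-branch (A ∨f B) w rewrite evK-branch A w | evK-branch B w = refl
  evK-branch (A ∧f B) w rewrite evK-branch A w | evK-branch B w = refl
  evK-branch (A ⇒ B) w rewrite evK-branch A w | evK-branch B w = refl
  evK-branch (¬f A) w rewrite evK-branch A w = refl

  evR : ∀ {Γ Δ} (r : Refutation Γ Δ) → Formula → Up (shape r)
  evR r ψ = ev ψ (valuation r)

  evKs : ∀ {Γ Δ} (ks : Children Γ Δ) → Formula → UpK (shapeK ks)
  evKs ks ψ = evK ψ (valuationK ks)

  restrict-evR : ∀ {Γ Δ} (s : Saturated Γ Δ) (ks : Children Γ Δ) ψ → restrict (evR (refutation s ks) ψ) ≡ evKs ks ψ
  restrict-evR s ks ψ = ≡.trans (restrict-ev ψ (valuation (refutation s ks))) (evK-ext ψ (λ n → restrict-valuation s ks))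

  evKs-child : ∀ {Γ Δ D Γ' Δ'} (c : ChildFor Γ D Γ' Δ') (r : Refutation Γ' Δ') (ks : Children Γ Δ) ψ →
    evKs (child c r ks) ψ ≡ (evR r ψ ∷ evKs ks ψ)
  evKs-child c r ks ψ = evK-branch ψ (valuationK (child c r ks))

  rootValue-all : ∀ {P : Set} {k} (d : Dec P) (x : UpK k) → rootValue d x ≡ all → P
  rootValue-all (yes p) x e = p
  rootValue-all (no _) x ()

  -- A child witnessing ¬A forces A, so A cannot lie in the empty up-set.
  ¬-childWitness : ∀ {k k'} {u : Up (node k')} {x y : UpK k} → u ≡ all →
          _⊑K_ {branch (node k') k} (u ∷ x) (botU (node k') ∷ y) → Empty.⊥
  ¬-childWitness refl (() ∷ _)

  HoldsInChildren : ∀ {Γ Δ} → Formula → Children Γ Δ → Set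
  HoldsInChildren (A ⇒ B) ks = evKs ks A ⊑K evKs ks B
  HoldsInChildren (¬f A) ks = evKs ks A ⊑K botK (shapeK ks)
  HoldsInChildren _ ks = Unit.⊤

  -- An implication on the left is true since it holds
  -- at the root (by saturation) and in every child (by induction); an
  -- implication on the right fails at the root (its antecedent is forced
  -- and consequent refuted there) or in its witnessing child.
  mutual
    forced : ∀ {Γ Δ} (r : Refutation Γ Δ) ψ → ψ ∈ Γ → evR r ψ ≡ all
    forced {Γ} (refutation s ks) (var n) p with var n ∈? Γ
    ... | yes _ = refl
    ... | no np = ⊥-elim (np p)
    forced r@(refutation s ks) (A ∨f B) p with Saturated.left-ok s p
    ... | inj₁ a = cong (_∪ evR r B) (forced r A a)
    ... | inj₂ b = ≡.trans (cong (evR r A ∪_) (forced r B b)) (∪all (evR r A))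
    forced r@(refutation s ks) (A ∧f B) p =
      cong₂ _∩_ (forced r A (proj₁ (Saturated.left-ok s p))) (forced r B (proj₂ (Saturated.left-ok s p)))
    forced r@(refutation s ks) (A ⇒ B) p = ⊑⇒⇨≡all (⊑-node (⇒-atRoot A B s ks (Saturated.left-ok s p))
      (subst₂ _⊑K_ (sym (restrict-evR s ks A)) (sym (restrict-evR s ks B)) (forcedInChildren (A ⇒ B) ks p)))
    forced r@(refutation s ks) (¬f A) p = ⊑⇒⇨≡all (⊑-node (λ e → ⊥-elim (refuted r A (Saturated.left-ok s p) e))
      (subst₂ _⊑K_ (sym (restrict-evR s ks A)) refl (forcedInChildren (¬f A) ks p)))

    ⇒-atRoot : ∀ {Γ Δ} A B (s : Saturated Γ Δ) (ks : Children Γ Δ) → (A ∈ Δ ⊎ B ∈ Γ) →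
      evR (refutation s ks) A ≡ all → evR (refutation s ks) B ≡ all
    ⇒-atRoot A B s ks (inj₁ a) e = ⊥-elim (refuted (refutation s ks) A a e)
    ⇒-atRoot A B s ks (inj₂ b) e = forced (refutation s ks) B b

    forcedInChildren : ∀ {Γ Δ} C (ks : Children Γ Δ) → C ∈ Γ → HoldsInChildren C ks
    forcedInChildren (var n) ks p = tt
    forcedInChildren (A ∨f B) ks p = tt
    forcedInChildren (A ∧f B) ks p = tt
    forcedInChildren (A ⇒ B) [] p = nil⊑ _ _
    forcedInChildren (A ⇒ B) (skip c ks) p = forcedInChildren (A ⇒ B) ks p
    forcedInChildren (A ⇒ B) (child c r ks) p =
      subst₂ _⊑K_ (sym (evKs-child c r ks A)) (sym (evKs-child c r ks B))
        (⇨≡all⇒⊑ (evR r A) (evR r B) (forced r (A ⇒ B) (childFor-⊆ c p)) ∷ forcedInChildren (A ⇒ B) ks p)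
    forcedInChildren (¬f A) [] p = nil⊑ _ _
    forcedInChildren (¬f A) (skip c ks) p = forcedInChildren (¬f A) ks p
    forcedInChildren (¬f A) (child c r ks) p =
      subst₂ _⊑K_ (sym (evKs-child c r ks A)) refl
        (⇨≡all⇒⊑ (evR r A) _ (forced r (¬f A) (childFor-⊆ c p)) ∷ forcedInChildren (¬f A) ks p)

    refuted : ∀ {Γ Δ} (r : Refutation Γ Δ) ψ → ψ ∈ Δ → evR r ψ ≡ all → Empty.⊥
    refuted {Γ} (refutation s ks) (var n) p e = Saturated.disjoint s (rootValue-all (var n ∈? Γ) _ e) p
    refuted r@(refutation s ks) (A ∨f B) p e with ∪≡all (evR r A) (evR r B) e
    ... | inj₁ ea = refuted r A (proj₁ (Saturated.right-ok s p)) ea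
    ... | inj₂ eb = refuted r B (proj₂ (Saturated.right-ok s p)) eb
    refuted r@(refutation s ks) (A ∧f B) p e with Saturated.right-ok s p
    ... | inj₁ a = refuted r A a (proj₁ (∩≡all (evR r A) (evR r B) e))
    ... | inj₂ b = refuted r B b (proj₂ (∩≡all (evR r A) (evR r B) e))
    refuted r@(refutation s ks) (A ⇒ B) p e =
      ⇒-witness A B ks p (subst₂ _⊑K_ (restrict-evR s ks A) (restrict-evR s ks B) (restrict-mono A⊑B))
        (λ a → refuted r B (Saturated.right-ok s p a) (all⊑ (subst (_⊑ evR r B) (forced r A a) A⊑B)))
      where
        A⊑B : evR r A ⊑ evR r B
        A⊑B = ⇨≡all⇒⊑ (evR r A) (evR r B) e
    refuted r@(refutation s ks) (¬f A) p e =
      ¬-witness A ks p (subst₂ _⊑K_ (restrict-evR s ks A) refl (restrict-mono A⊑∅))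
        (λ a → all⊑sub (subst (_⊑ botU (shape r)) (forced r A a) A⊑∅))
      where
        A⊑∅ : evR r A ⊑ botU (shape r)
        A⊑∅ = ⇨≡all⇒⊑ (evR r A) _ e

    -- An implication A ⇒ B on the right that holds in every child fails
    -- at its own witness: either A is forced at the root, or the child
    -- built for it forces A and refutes B.
    ⇒-witness : ∀ {Γ Δ} A B (ks : Children Γ Δ) → (A ⇒ B) ∈ Δ →
      evKs ks A ⊑K evKs ks B → A ∉ Γ → Empty.⊥
    ⇒-witness A B (skip (settled-⇒ a) ks) (here refl) A⊑B a∉Γ = a∉Γ a
    ⇒-witness A B (child c@(child-⇒ _ a b) r ks) (here refl) A⊑B a∉Γ =
      ⇒-childWitness A B r b (forced r A a) (subst₂ _⊑K_ (evKs-child c r ks A) (evKs-child c r ks B) A⊑B)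
    ⇒-witness A B (skip c ks) (there p) A⊑B a∉Γ = ⇒-witness A B ks p A⊑B a∉Γ
    ⇒-witness A B (child c r ks) (there p) A⊑B a∉Γ =
      ⇒-witness A B ks p (tl⊑ (subst₂ _⊑K_ (evKs-child c r ks A) (evKs-child c r ks B) A⊑B)) a∉Γ

    ⇒-childWitness : ∀ {Γ' Δ' k} A B {x y : UpK k} (r : Refutation Γ' Δ') → B ∈ Δ' → evR r A ≡ all →
      _⊑K_ {branch (shape r) k} (evR r A ∷ x) (evR r B ∷ y) → Empty.⊥
    ⇒-childWitness A B r b A≡all (A⊑B ∷ _) = refuted r B b (all⊑ (subst (_⊑ evR r B) A≡all A⊑B))

    ¬-witness : ∀ {Γ Δ} A (ks : Children Γ Δ) → (¬f A) ∈ Δ →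
      evKs ks A ⊑K botK (shapeK ks) → A ∉ Γ → Empty.⊥
    ¬-witness A (skip (settled-¬ a) ks) (here refl) A⊑∅ a∉Γ = a∉Γ a
    ¬-witness A (child c@(child-¬ _ a) r@(refutation _ _) ks) (here refl) A⊑∅ a∉Γ =
      ¬-childWitness (forced r A a) (subst₂ _⊑K_ (evKs-child c r ks A) refl A⊑∅)
    ¬-witness A (skip c ks) (there p) A⊑∅ a∉Γ = ¬-witness A ks p A⊑∅ a∉Γ
    ¬-witness A (child c r ks) (there p) A⊑∅ a∉Γ =
      ¬-witness A ks p (tl⊑ (subst₂ _⊑K_ (evKs-child c r ks A) refl A⊑∅)) a∉Γ

module LatticeFacts (D : DistributiveLattice 0ℓ 0ℓ 0ℓ) where
  open DistributiveLattice D public renaming (refl to ≤-refl)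
  open JoinSemilatticeProperties joinSemilattice public
    using (∨-monotonic; ∨-cong; ∨-comm; ∨-idempotent; x≤y⇒x∨y≈y)
  open MeetSemilatticeProperties meetSemilattice public
    using (∧-monotonic; ∧-cong; ∧-comm; ∧-idempotent; y≤x⇒x∧y≈y)
  open DistributiveProperties D using (∨-distribˡ-∧; ∧-distribʳ-∨)

  ≈⇒≥ : ∀ {x y} → x ≈ y → y ≤ x
  ≈⇒≥ x≈y = reflexive (Eq.sym x≈y)

  ≤-∨ˡ : ∀ {a x y} → a ≤ x → a ≤ (x ∨ y)
  ≤-∨ˡ a≤x = trans a≤x (x≤x∨y _ _)

  y≤x⇒x∨y≈x : ∀ {x y} → y ≤ x → (x ∨ y) ≈ x
  y≤x⇒x∨y≈x y≤x = Eq.trans (∨-comm _ _) (x≤y⇒x∨y≈y y≤x)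

  x≤y⇒x∧y≈x : ∀ {x y} → x ≤ y → (x ∧ y) ≈ x
  x≤y⇒x∧y≈x x≤y = Eq.trans (∧-comm _ _) (y≤x⇒x∧y≈y x≤y)

  ∨-interchange : ∀ a b c d → ((a ∨ b) ∨ (c ∨ d)) ≈ ((a ∨ c) ∨ (b ∨ d))
  ∨-interchange a b c d = antisym shuffle shuffle
    where
      shuffle : ∀ {a b c d} → ((a ∨ b) ∨ (c ∨ d)) ≤ ((a ∨ c) ∨ (b ∨ d))
      shuffle = ∨-least (∨-monotonic (x≤x∨y _ _) (x≤x∨y _ _)) (∨-monotonic (y≤x∨y _ _) (y≤x∨y _ _))

  ∧-∨-expand : ∀ a b c d → ((a ∨ b) ∧ (c ∨ d)) ≤ (((a ∧ c) ∨ (a ∧ d)) ∨ ((b ∧ c) ∨ (b ∧ d)))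
  ∧-∨-expand a b c d = trans (reflexive (∧-distribʳ-∨ _ _ _))
    (∨-monotonic (reflexive (∧-distribˡ-∨ a c d)) (reflexive (∧-distribˡ-∨ b c d)))

  meet-below : ∀ {a b c p q} → (p ∧ q) ≤ c → a ≤ (c ∨ p) → b ≤ (c ∨ q) → (a ∧ b) ≤ c
  meet-below p∧q≤c a≤c∨p b≤c∨q = trans (∧-monotonic a≤c∨p b≤c∨q)
    (trans (reflexive (Eq.sym (∨-distribˡ-∧ _ _ _))) (∨-least ≤-refl p∧q≤c))

-- The up-set lattice of a finite tree is weakly projective.

-- Given a surjective homomorphism f : L₀ ↠ L₁ and a homomorphism
-- g : Up t → L₁, a lift h : Up t → L₀ with f ∘ h = g is defined by
-- recursion on the tree.  Choose preimages of the values of g; the whole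
-- tree is sent to c ∨ M, where M lifts g(whole tree) and the base c lifts
-- g(∅), and a rootless up-set is sent to the join of the lifts of its
-- components, each computed inside its subtree with the top lift cut
-- down below M.  Joins are preserved by construction.  Meets are
-- preserved once c absorbs a 'defect': the meets of lifts living on
-- disjoint subtrees, which f sends to g(∅) because g preserves meets.

module Projectivity where
  open UpSets

  module Lifting (t₀ : Tree) (L₀ L₁ : DistributiveLattice 0ℓ 0ℓ 0ℓ)
    (f : DistributiveLattice.Carrier L₀ → DistributiveLattice.Carrier L₁)
    (fh : IsLatticeHom (DistributiveLattice.lattice L₀) (DistributiveLattice.lattice L₁) f)
    (surj : ∀ y → ∃ λ x → DistributiveLattice._≈_ L₁ (f x) y) where

    module A = LatticeFacts L₀
    module B = LatticeFacts L₁
    open SetoidReasoning B.setoid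
    C₀ C₁ : Set
    C₀ = A.Carrier
    C₁ = B.Carrier

    preimage : C₁ → C₀
    preimage y = proj₁ (surj y)
    preimage-correct : ∀ y → f (preimage y) B.≈ y
    preimage-correct y = proj₂ (surj y)

    f-∨ : ∀ x y → f (x A.∨ y) B.≈ (f x B.∨ f y)
    f-∨ = IsLatticeHom.∨-hom fh
    f-∧ : ∀ x y → f (x A.∧ y) B.≈ (f x B.∧ f y)
    f-∧ = IsLatticeHom.∧-hom fh

    ≡⇒≈ : ∀ {x y : C₁} → x ≡ y → x B.≈ y
    ≡⇒≈ refl = B.Eq.refl

    record Preserves {X : Set} (_⊕_ _⊗_ : X → X → X) (g : X → C₁) : Set where
      field
        ∨-pres : ∀ x y → g (x ⊕ y) B.≈ (g x B.∨ g y)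
        ∧-pres : ∀ x y → g (x ⊗ y) B.≈ (g x B.∧ g y)
    open Preserves

    HomU : ∀ t → (Up t → C₁) → Set
    HomU t g = Preserves (_∪_ {t}) _∩_ g
    HomK : ∀ k → (UpK k → C₁) → Set
    HomK k g = Preserves (_∪K_ {k}) _∩K_ g

    onHead : ∀ {t k} → (UpK (branch t k) → C₁) → Up t → C₁
    onHead {k = k} g u = g (u ∷ botK k)
    onTail : ∀ {t k} → (UpK (branch t k) → C₁) → UpK k → C₁
    onTail {t} g x = g (botU t ∷ x)
    onSub : ∀ {k} → (Up (node k) → C₁) → UpK k → C₁
    onSub g x = g (sub x)

    onHead-hom : ∀ {t k} {g : UpK (branch t k) → C₁} → HomK (branch t k) g → HomU t (onHead g)
    onHead-hom {t} {k} {g} h = record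
      { ∨-pres = λ u v → B.Eq.trans (≡⇒≈ (cong (λ w → g ((u ∪ v) ∷ w)) (sym (∪K-idem (botK k))))) (∨-pres h _ _)
      ; ∧-pres = λ u v → B.Eq.trans (≡⇒≈ (cong (λ w → g ((u ∩ v) ∷ w)) (sym (∩K-idem (botK k))))) (∧-pres h _ _) }
    onTail-hom : ∀ {t k} {g : UpK (branch t k) → C₁} → HomK (branch t k) g → HomK k (onTail g)
    onTail-hom {t} {k} {g} h = record
      { ∨-pres = λ x y → B.Eq.trans (≡⇒≈ (cong (λ w → g (w ∷ (x ∪K y))) (sym (∪-idem (botU t))))) (∨-pres h _ _)
      ; ∧-pres = λ x y → B.Eq.trans (≡⇒≈ (cong (λ w → g (w ∷ (x ∩K y))) (sym (∩-idem (botU t))))) (∧-pres h _ _) }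
    onSub-hom : ∀ {k} {g : Up (node k) → C₁} → HomU (node k) g → HomK k (onSub g)
    onSub-hom h = record { ∨-pres = λ x y → ∨-pres h (sub x) (sub y) ; ∧-pres = λ x y → ∧-pres h (sub x) (sub y) }

    homU-mono : ∀ {t} {g : Up t → C₁} → HomU t g → ∀ {u v} → u ⊑ v → g u B.≤ g v
    homU-mono {g = g} h {u} {v} p = B.trans (B.x≤x∨y _ _)
      (B.≈⇒≥ (B.Eq.trans (≡⇒≈ (cong g (sym (⊑-antisym (∪-least p (⊑-refl v)) (∪-r u v))))) (∨-pres h u v)))
    homK-mono : ∀ {k} {g : UpK k → C₁} → HomK k g → ∀ {x y} → x ⊑K y → g x B.≤ g y
    homK-mono {g = g} h {x} {y} p = B.trans (B.x≤x∨y _ _)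
      (B.≈⇒≥ (B.Eq.trans (≡⇒≈ (cong g (sym (⊑K-antisym (∪K-least p (⊑K-refl y)) (∪K-r x y))))) (∨-pres h x y)))

    -- The lift of the value of the whole first subtree, cut down below the
    -- lift M of the whole forest; it still maps to the right value.
    headTop : ∀ {t k} → C₀ → (UpK (branch t k) → C₁) → C₀
    headTop M g = M A.∧ preimage (onHead g all)

    f-headTop : ∀ {t k} {g : UpK (branch t k) → C₁} {M} → HomK (branch t k) g → g (topK (branch t k)) B.≤ f M →
         f (headTop M g) B.≈ onHead g all
    f-headTop {t} {k} {g} {M} h le = B.Eq.trans (f-∧ _ _) (B.Eq.trans (B.∧-cong B.Eq.refl (preimage-correct _))
      (B.y≤x⇒x∧y≈y (B.trans (homK-mono h (⊑all ∷ botK-min k (topK k))) le)))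

    module WithBottom (z : C₀) where
      topLiftK : ∀ k → (UpK k → C₁) → C₀ → C₀
      topLiftK [] g M = z
      topLiftK (branch t k) g M = headTop M g A.∨ topLiftK k (onTail g) M

      -- The defect: the meets of lifts that live on disjoint subtrees,
      -- collected over the whole tree.
      mutual
        defect : ∀ t → (Up t → C₁) → C₀ → C₀
        defect (node k) g M = defectK k (onSub g) M
        defectK : ∀ k → (UpK k → C₁) → C₀ → C₀
        defectK [] g M = z
        defectK (branch t k) g M =
          ((headTop M g A.∧ topLiftK k (onTail g) M) A.∨ defect t (onHead g) (headTop M g))
            A.∨ defectK k (onTail g) M

      f-topLiftK : ∀ k {g : UpK k → C₁} {M} → HomK k g → f z B.≈ g (botK k) → g (topK k) B.≤ f M →
            f (topLiftK k g M) B.≈ g (topK k)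
      f-topLiftK [] h ez le = ez
      f-topLiftK (branch t k) {g} {M} h ez le = begin
        f (headTop M g A.∨ topLiftK k (onTail g) M)          ≈⟨ f-∨ _ _ ⟩
        f (headTop M g) B.∨ f (topLiftK k (onTail g) M)      ≈⟨ B.∨-cong (f-headTop h le) (f-topLiftK k (onTail-hom h) ez le') ⟩
        g (all ∷ botK k) B.∨ g (botU t ∷ topK k)             ≈⟨ ∨-pres h _ _ ⟨
        g (all ∷ (botK k ∪K topK k))                         ≡⟨ cong (λ w → g (all ∷ w)) (botK∪ k (topK k)) ⟩
        g (all ∷ topK k)                                     ∎
        where
          le' : onTail g (topK k) B.≤ f M
          le' = B.trans (homK-mono h (⊑all ∷ ⊑K-refl (topK k))) le

      mutual
        f-defect : ∀ t {g : Up t → C₁} {M} → HomU t g → f z B.≈ g (botU t) → f M B.≈ g all →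
              f (defect t g M) B.≈ g (botU t)
        f-defect (node k) h ez eM = f-defectK k (onSub-hom h) ez (B.trans (homU-mono h ⊑all) (B.≈⇒≥ eM))
        f-defectK : ∀ k {g : UpK k → C₁} {M} → HomK k g → f z B.≈ g (botK k) → g (topK k) B.≤ f M →
              f (defectK k g M) B.≈ g (botK k)
        f-defectK [] h ez le = ez
        f-defectK (branch t k) {g} {M} h ez le = begin
          f (((P A.∧ J) A.∨ D₁) A.∨ D₂)                ≈⟨ f-∨ _ _ ⟩
          f ((P A.∧ J) A.∨ D₁) B.∨ f D₂                ≈⟨ B.∨-cong (f-∨ _ _) B.Eq.refl ⟩
          (f (P A.∧ J) B.∨ f D₁) B.∨ f D₂              ≈⟨ B.∨-cong (B.∨-cong (f-∧ _ _) B.Eq.refl) B.Eq.refl ⟩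
          ((f P B.∧ f J) B.∨ f D₁) B.∨ f D₂
            ≈⟨ B.∨-cong (B.∨-cong (B.∧-cong (f-headTop h le) (f-topLiftK k (onTail-hom h) ez le'))
                                  (f-defect t (onHead-hom h) ez (f-headTop h le)))
                        (f-defectK k (onTail-hom h) ez le') ⟩
          ((g (all ∷ botK k) B.∧ g (botU t ∷ topK k)) B.∨ g ∅) B.∨ g ∅
            ≈⟨ B.∨-cong (B.∨-cong disjoint B.Eq.refl) B.Eq.refl ⟩
          (g ∅ B.∨ g ∅) B.∨ g ∅                       ≈⟨ B.∨-cong (B.∨-idempotent _) B.Eq.refl ⟩
          g ∅ B.∨ g ∅                                 ≈⟨ B.∨-idempotent _ ⟩
          g ∅                                         ∎
          where
            P = headTop M g
            J = topLiftK k (onTail g) M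
            D₁ = defect t (onHead g) P
            D₂ = defectK k (onTail g) M
            ∅ = botK (branch t k)
            le' : onTail g (topK k) B.≤ f M
            le' = B.trans (homK-mono h (⊑all ∷ ⊑K-refl (topK k))) le
            -- The whole first subtree and the rest of the forest are disjoint.
            disjoint : (g (all ∷ botK k) B.∧ g (botU t ∷ topK k)) B.≈ g ∅
            disjoint = B.Eq.trans (B.Eq.sym (∧-pres h _ _)) (≡⇒≈ (cong (λ w → g (botU t ∷ w)) (∩topK (botK k))))

      -- Fix the base c, a lift of g(∅) (later chosen to absorb the defect).
      module WithBase (c : C₀) where
        mutual
          lift : ∀ {t} → (Up t → C₁) → C₀ → Up t → C₀
          lift g M all = c A.∨ M
          lift g M (sub x) = liftK (onSub g) M x
          liftK : ∀ {k} → (UpK k → C₁) → C₀ → UpK k → C₀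
          liftK g M [] = c
          liftK g M (u ∷ x) = lift (onHead g) (headTop M g) u A.∨ liftK (onTail g) M x

        mutual
          base≤lift : ∀ {t} (g : Up t → C₁) M u → c A.≤ lift g M u
          base≤lift g M all = A.x≤x∨y _ _
          base≤lift g M (sub x) = base≤liftK (onSub g) M x
          base≤liftK : ∀ {k} (g : UpK k → C₁) M x → c A.≤ liftK g M x
          base≤liftK g M [] = A.≤-refl
          base≤liftK g M (u ∷ x) = A.≤-∨ˡ (base≤lift (onHead g) (headTop M g) u)

        mutual
          lift≤top : ∀ {t} (g : Up t → C₁) M u → lift g M u A.≤ (c A.∨ M)
          lift≤top g M all = A.≤-refl
          lift≤top g M (sub x) = liftK≤top (onSub g) M x
          liftK≤top : ∀ {k} (g : UpK k → C₁) M x → liftK g M x A.≤ (c A.∨ M)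
          liftK≤top g M [] = A.x≤x∨y _ _
          liftK≤top g M (u ∷ x) = A.∨-least
            (A.trans (lift≤top (onHead g) (headTop M g) u) (A.∨-monotonic A.≤-refl (A.x∧y≤x _ _)))
            (liftK≤top (onTail g) M x)

        liftK≤topLiftK : ∀ {k} (g : UpK k → C₁) M x → liftK g M x A.≤ (c A.∨ topLiftK k g M)
        liftK≤topLiftK g M [] = A.x≤x∨y _ _
        liftK≤topLiftK g M (u ∷ x) = A.∨-least
          (A.trans (lift≤top (onHead g) (headTop M g) u) (A.∨-monotonic A.≤-refl (A.x≤x∨y _ _)))
          (A.trans (liftK≤topLiftK (onTail g) M x) (A.∨-monotonic A.≤-refl (A.y≤x∨y _ _)))

        mutual
          lift-∪ : ∀ {t} (g : Up t → C₁) M u v → lift g M (u ∪ v) A.≈ (lift g M u A.∨ lift g M v)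
          lift-∪ g M all v = A.Eq.sym (A.y≤x⇒x∨y≈x (lift≤top g M v))
          lift-∪ g M (sub x) all = A.Eq.sym (A.x≤y⇒x∨y≈y (lift≤top g M (sub x)))
          lift-∪ g M (sub x) (sub y) = liftK-∪ (onSub g) M x y
          liftK-∪ : ∀ {k} (g : UpK k → C₁) M x y → liftK g M (x ∪K y) A.≈ (liftK g M x A.∨ liftK g M y)
          liftK-∪ g M [] [] = A.Eq.sym (A.∨-idempotent _)
          liftK-∪ g M (u ∷ x) (v ∷ y) = A.Eq.trans
            (A.∨-cong (lift-∪ (onHead g) (headTop M g) u v) (liftK-∪ (onTail g) M x y))
            (A.∨-interchange _ _ _ _)

        -- The lift preserves meets as soon as c absorbs the defect.  On a
        -- forest the meet of (head u ∨ tail x) and (head v ∨ tail y) expands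
        -- into four terms; the two cross terms lie below c.
        mutual
          lift-∩ : ∀ {t} (g : Up t → C₁) M → defect t g M A.≤ c →
            ∀ u v → lift g M (u ∩ v) A.≈ (lift g M u A.∧ lift g M v)
          lift-∩ g M hc all v = A.Eq.sym (A.y≤x⇒x∧y≈y (lift≤top g M v))
          lift-∩ g M hc (sub x) all = A.Eq.sym (A.x≤y⇒x∧y≈x (lift≤top g M (sub x)))
          lift-∩ {node k} g M hc (sub x) (sub y) = liftK-∩ (onSub g) M hc x y
          liftK-∩ : ∀ {k} (g : UpK k → C₁) M → defectK k g M A.≤ c →
            ∀ x y → liftK g M (x ∩K y) A.≈ (liftK g M x A.∧ liftK g M y)
          liftK-∩ g M hc [] [] = A.Eq.sym (A.∧-idempotent _)
          liftK-∩ {branch t k} g M hc (u ∷ x) (v ∷ y) = A.antisym le1 le2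
            where
              Pm J Hu Hv Kx Ky : C₀
              Pm = headTop M g
              J = topLiftK k (onTail g) M
              Hu = lift (onHead g) Pm u
              Hv = lift (onHead g) Pm v
              Kx = liftK (onTail g) M x
              Ky = liftK (onTail g) M y
              hpair : (Pm A.∧ J) A.≤ c
              hpair = A.trans (A.≤-∨ˡ (A.x≤x∨y _ _)) hc
              hcs : defect t (onHead g) Pm A.≤ c
              hcs = A.trans (A.≤-∨ˡ (A.y≤x∨y _ _)) hc
              hck : defectK k (onTail g) M A.≤ c
              hck = A.trans (A.y≤x∨y _ _) hc
              lhs≈ : (lift (onHead g) Pm (u ∩ v) A.∨ liftK (onTail g) M (x ∩K y)) A.≈ ((Hu A.∧ Hv) A.∨ (Kx A.∧ Ky))
              lhs≈ = A.∨-cong (lift-∩ (onHead g) Pm hcs u v) (liftK-∩ (onTail g) M hck x y)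
              le1 : (lift (onHead g) Pm (u ∩ v) A.∨ liftK (onTail g) M (x ∩K y)) A.≤ ((Hu A.∨ Kx) A.∧ (Hv A.∨ Ky))
              le1 = A.trans (A.reflexive lhs≈) (A.∨-least (A.∧-monotonic (A.x≤x∨y _ _) (A.x≤x∨y _ _))
                                                    (A.∧-monotonic (A.y≤x∨y _ _) (A.y≤x∨y _ _)))
              cle : c A.≤ (Hu A.∧ Hv)
              cle = A.∧-greatest (base≤lift (onHead g) Pm u) (base≤lift (onHead g) Pm v)
              c1 : (Hu A.∧ Ky) A.≤ c
              c1 = A.meet-below hpair (lift≤top (onHead g) Pm u) (liftK≤topLiftK (onTail g) M y)
              c2 : (Kx A.∧ Hv) A.≤ c
              c2 = A.meet-below (A.trans (A.reflexive (A.∧-comm _ _)) hpair)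
                     (liftK≤topLiftK (onTail g) M x) (lift≤top (onHead g) Pm v)
              le2 : ((Hu A.∨ Kx) A.∧ (Hv A.∨ Ky)) A.≤ (lift (onHead g) Pm (u ∩ v) A.∨ liftK (onTail g) M (x ∩K y))
              le2 = A.trans (A.∧-∨-expand Hu Kx Hv Ky) (A.trans
                (A.∨-least (A.∨-least (A.x≤x∨y _ _) (A.≤-∨ˡ (A.trans c1 cle)))
                           (A.∨-least (A.≤-∨ˡ (A.trans c2 cle)) (A.y≤x∨y _ _)))
                (A.≈⇒≥ lhs≈))

        mutual
          f∘lift : ∀ {t} (g : Up t → C₁) M → HomU t g → f c B.≈ g (botU t) → f M B.≈ g all →
               ∀ u → f (lift g M u) B.≈ g u
          f∘lift {t} g M h ec eM all = begin
            f (c A.∨ M)           ≈⟨ f-∨ _ _ ⟩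
            f c B.∨ f M           ≈⟨ B.∨-cong ec eM ⟩
            g (botU t) B.∨ g all  ≈⟨ ∨-pres h _ _ ⟨
            g (botU t ∪ all)      ≡⟨ cong g (∪all (botU t)) ⟩
            g all                 ∎
          f∘lift {node k} g M h ec eM (sub x) =
            f∘liftK (onSub g) M (onSub-hom h) ec (B.trans (homU-mono h ⊑all) (B.≈⇒≥ eM)) x
          f∘liftK : ∀ {k} (g : UpK k → C₁) M → HomK k g → f c B.≈ g (botK k) → g (topK k) B.≤ f M →
                ∀ x → f (liftK g M x) B.≈ g x
          f∘liftK g M h ec le [] = ec
          f∘liftK {branch t k} g M h ec le (u ∷ x) = begin
            f (lift (onHead g) (headTop M g) u A.∨ liftK (onTail g) M x)
              ≈⟨ f-∨ _ _ ⟩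
            f (lift (onHead g) (headTop M g) u) B.∨ f (liftK (onTail g) M x)
              ≈⟨ B.∨-cong (f∘lift (onHead g) (headTop M g) (onHead-hom h) ec (f-headTop h le) u)
                          (f∘liftK (onTail g) M (onTail-hom h) ec le' x) ⟩
            g (u ∷ botK k) B.∨ g (botU t ∷ x)
              ≈⟨ ∨-pres h _ _ ⟨
            g ((u ∪ botU t) ∷ (botK k ∪K x))
              ≡⟨ cong₂ (λ a b → g (a ∷ b)) (∪bot t u) (botK∪ k x) ⟩
            g (u ∷ x) ∎
            where
              le' : onTail g (topK k) B.≤ f M
              le' = B.trans (homK-mono h (⊑all ∷ ⊑K-refl (topK k))) le

    solution : (g : Up t₀ → C₁) →
      IsLatticeHom (HeytingAlgebra.lattice (upSets t₀)) (DistributiveLattice.lattice L₁) g →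
      Σ (Up t₀ → C₀) λ h →
        IsLatticeHom (HeytingAlgebra.lattice (upSets t₀)) (DistributiveLattice.lattice L₀) h ×
        (∀ u → g u B.≈ f (h u))
    solution g g-hom = lift g M , lift-hom , λ u → B.Eq.sym (f∘lift g M hom f-base (preimage-correct _) u)
      where
        hom : HomU t₀ g
        hom = record { ∨-pres = IsLatticeHom.∨-hom g-hom ; ∧-pres = IsLatticeHom.∧-hom g-hom }
        z M : C₀
        z = preimage (g (botU t₀))
        M = preimage (g all)
        open WithBottom z
        c : C₀
        c = z A.∨ defect t₀ g M
        open WithBase c
        lift-hom : IsLatticeHom (HeytingAlgebra.lattice (upSets t₀)) (DistributiveLattice.lattice L₀) (lift g M)
        lift-hom = record
          { cong = λ { refl → A.Eq.refl } ; ∨-hom = lift-∪ g M ; ∧-hom = lift-∩ g M (A.y≤x∨y _ _) }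
        f-base : f c B.≈ g (botU t₀)
        f-base = begin
          f (z A.∨ defect t₀ g M)                ≈⟨ f-∨ _ _ ⟩
          f z B.∨ f (defect t₀ g M)
            ≈⟨ B.∨-cong (preimage-correct _) (f-defect t₀ hom (preimage-correct _) (preimage-correct _)) ⟩
          g (botU t₀) B.∨ g (botU t₀)            ≈⟨ B.∨-idempotent _ ⟩
          g (botU t₀)                            ∎

  upSets-weaklyProjective : ∀ t → WeaklyProjective (HeytingAlgebra.lattice (upSets t))
  upSets-weaklyProjective t L₀ L₁ f f-hom f-onto = Lifting.solution t L₀ L₁ f f-hom f-onto

open Duality using (brouwerOf; ⟦⟧-brouwerOf; weaklyProjective-brouwerOf)
open Soundness using (soundH; soundB)
open ProofSearch using (decide)
open UpSets using (Tree; Up; all; upSets; upSets-finite)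
open TruthLemma using (shape; valuation; refuted)
open Projectivity using (upSets-weaklyProjective)

refutedInTree : ∀ φ →
  IPC⊢ φ ⊎ Σ[ t ∈ Tree ] Σ[ v ∈ (ℕ → Up t) ] ¬ (⟦_⟧H (upSets t) φ v ≡ all)
refutedInTree φ with decide φ
... | inj₁ d = inj₁ d
... | inj₂ (Γ , Δ , φ∈Δ , r) = inj₂ (shape r , valuation r , refuted r φ φ∈Δ)

completeH : ∀ φ → InAllFinWPHeyting φ → IPC⊢ φ
completeH φ trueInAll with refutedInTree φ
... | inj₁ d = d
... | inj₂ (t , v , notTrue) =
  ⊥-elim (notTrue (trueInAll (upSets t) (upSets-finite t) (upSets-weaklyProjective t) v))

completeB : ∀ φ → InAllFinWPBrouwer φ → IPC⊢ φ
completeB φ trueInAll with refutedInTree φ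
... | inj₁ d = d
... | inj₂ (t , v , notTrue) =
  ⊥-elim (notTrue (≡.trans (sym (⟦⟧-brouwerOf (upSets t) φ v))
    (trueInAll (brouwerOf (upSets t)) (upSets-finite t)
      (weaklyProjective-brouwerOf (upSets t) (upSets-weaklyProjective t)) v)))

corollary3p11 : (φ : Formula) →
    ((IPC⊢ φ) ⇔ InAllFinWPBrouwer φ) × ((IPC⊢ φ) ⇔ InAllFinWPHeyting φ)
corollary3p11 φ =
  mk⇔ (λ d B _ _ → soundB B d) (completeB φ) ,
  mk⇔ (λ d H _ _ → soundH H d) (completeH φ)
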